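{- For every permutation $\pi$, $\mathrm{Des}(\mathrm{swu}(\pi))=\mathrm{Des}(\mathrm{swd}(\pi))=\mathrm{Des}(\pi)$. If $\pi\in\mathrm{Av}(312)$, then $\mathrm{des}(\mathrm{swr}(\pi))=\mathrm{des}(\pi^{ -1})=\mathrm{des}(\pi)$. If $\pi\in\mathrm{Av}(132)$, then $\mathrm{des}(\mathrm{swl}(\pi))=\mathrm{des}(\pi^{ -1})=\mathrm{des}(\pi)$.
   Context: $S_n$ is the set of permutations of $[n]$ in one-line notation; operators on arbitrary permutations (words of distinct positive integers) are defined by normalizing (replacing the $i$-th smallest entry by $i$), applying the operator, and un-normalizing. A descent of $\pi$ is an index $i$ with $\pi_i>\pi_{i+1}$; $\mathrm{Des}(\pi)$ is the set of descents and $\mathrm{des}(\pi)=|\mathrm{Des}(\pi)|$. $\mathrm{Av}(\tau)$ is the set of permutations in $\bigcup_n S_n$ with no subsequence of the same relative order as $\tau$. $\mathrm{rev}$ reverses a word, $\pi^{ -1}$ is the group inverse, $\mathrm{rot}(\pi)=\mathrm{rev}(\pi^{ -1})$, and $\mathrm{rot}^{ -1}$ is its inverse. Sliding operators: for $\pi\in S_n$, $i\in[n]$, let $L_i$ (resp. $R_i$) be the set of elements of $[i-1]$ to the left (resp. right) of the entry $i$ in $\pi$. $\mathrm{swu}_i(\pi)$ has $j$-th entry $\pi_j$ if $\pi_j\ge i$, $m$ if $\pi_j$ is the $m$-th smallest element of $R_i$, and $i-m$ if $\pi_j$ is the $m$-th largest element of $L_i$. Let $\mathrm{swd}_i=\mathrm{rev}\circ\mathrm{swu}_i\circ\mathrm{rev}$,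 $\mathrm{swl}_i=\mathrm{rot}^{ -1}\circ\mathrm{swu}_i\circ\mathrm{rot}$, $\mathrm{swr}_i=\mathrm{rot}^{ -1}\circ\mathrm{swd}_i\circ\mathrm{rot}$, and on $S_n$ set $\mathrm{swu}=\mathrm{swu}_1\circ\cdots\circ\mathrm{swu}_n$, and similarly $\mathrm{swd},\mathrm{swl},\mathrm{swr}$. -}

module Defs where

open import Data.Nat using (ℕ; zero; suc; _∸_; _<ᵇ_; _≤ᵇ_; _≡ᵇ_)
open import Data.Bool using (Bool; true; false; if_then_else_; not)
open import Data.List using (List; []; _∷_; map; reverse; upTo; length; foldr)
open import Data.List.Relation.Binary.Permutation.Propositional using (_↭_)
open import Data.List.Relation.Binary.Sublist.Propositional using (_⊆_)
open import Data.Product using (∃; _×_)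
open import Relation.Binary.PropositionalEquality using (_≡_)
open import Relation.Nullary using (¬_)

[1‥_] : ℕ → List ℕ
[1‥ n ] = map suc (upTo n)

-- π ∈ S_n : one-line notation, a rearrangement of 1 … n
IsPerm : ℕ → List ℕ → Set
IsPerm n π = π ↭ [1‥ n ]

count : (ℕ → Bool) → List ℕ → ℕ
count p [] = 0
count p (x ∷ xs) = if p x then suc (count p xs) else count p xs

keep : (ℕ → Bool) → List ℕ → List ℕ
keep p [] = []
keep p (x ∷ xs) = if p x then x ∷ keep p xs else keep p xs

anyB : (ℕ → Bool) → List ℕ → Bool
anyB p [] = false
anyB p (x ∷ xs) = if p x then true else anyB p xs

before : ℕ → List ℕ → List ℕ
before i [] = []
before i (x ∷ xs) = if x ≡ᵇ i then [] else x ∷ before i xs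

after : ℕ → List ℕ → List ℕ
after i [] = []
after i (x ∷ xs) = if x ≡ᵇ i then xs else after i xs

Lset Rset : ℕ → List ℕ → List ℕ
Lset i π = keep (_<ᵇ i) (before i π)
Rset i π = keep (_<ᵇ i) (after i π)

swuᵢ : ℕ → List ℕ → List ℕ
swuᵢ i π = map f π
  where
  f : ℕ → ℕ
  f x = if i ≤ᵇ x then x
        else if anyB (x ≡ᵇ_) (Rset i π)
             -- x is the m-th smallest of R_i, m = 1 + #{y ∈ R_i | y < x}
             then suc (count (_<ᵇ x) (Rset i π))
             -- x is the m-th largest of L_i, m = 1 + #{y ∈ L_i | y > x}
             else i ∸ suc (count (x <ᵇ_) (Lset i π))

rev : List ℕ → List ℕ
rev = reverse

pos : ℕ → List ℕ → ℕ
pos j [] = 0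
pos j (x ∷ xs) = if x ≡ᵇ j then 1 else suc (pos j xs)

inv : List ℕ → List ℕ
inv π = map (λ j → pos j π) [1‥ length π ]

rot : List ℕ → List ℕ
rot π = rev (inv π)

rot⁻¹ : List ℕ → List ℕ
rot⁻¹ σ = inv (rev σ)

swdᵢ swlᵢ swrᵢ : ℕ → List ℕ → List ℕ
swdᵢ i π = rev (swuᵢ i (rev π))
swlᵢ i π = rot⁻¹ (swuᵢ i (rot π))
swrᵢ i π = rot⁻¹ (swdᵢ i (rot π))

-- op_1 ∘ op_2 ∘ ⋯ ∘ op_n  (op_n applied first), n = length π
compose : (ℕ → List ℕ → List ℕ) → List ℕ → List ℕ
compose op π = foldr op π [1‥ length π ]

swu swd swl swr : List ℕ → List ℕ
swu = compose swuᵢ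
swd = compose swdᵢ
swl = compose swlᵢ
swr = compose swrᵢ

-- Des(π) as the increasing list of (1-based) descent indices
desFrom : ℕ → List ℕ → List ℕ
desFrom k [] = []
desFrom k (x ∷ []) = []
desFrom k (x ∷ y ∷ rest) =
  if y <ᵇ x then k ∷ desFrom (suc k) (y ∷ rest) else desFrom (suc k) (y ∷ rest)

Des : List ℕ → List ℕ
Des = desFrom 1

des : List ℕ → ℕ
des π = length (Des π)

normalize : List ℕ → List ℕ
normalize w = map (λ x → suc (count (_<ᵇ x) w)) w

Contains : List ℕ → List ℕ → Set
Contains π τ = ∃ λ σ → σ ⊆ π × normalize σ ≡ τ

Av : List ℕ → List ℕ → Set
Av τ π = ¬ Contains π τ

{-# OPTIONS --safe #-}

-- Write swuᵢ π = map f π, where f fixes the entries ≥ i, relabels the entries < i lying to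
-- the left of i (the list L) and to its right (R) order-preservingly, and sends R below L.
-- Two adjacent entries are never split between L and R, so f keeps their relative order and
-- the descent set is unchanged; swdᵢ is the mirror image.  After swuⱼ ∘ ⋯ ∘ swuₙ no
-- occurrence of 132 has its 3 at least j: one created at step j would have 3 = j, its 1 in L
-- and its 2 in R, which f puts in the wrong order.  Hence swu π avoids 132 and swd π avoids
-- 231.  Conjugating by rot gives swr π = (swu π⁻¹)⁻¹ and swl π = (swd π⁻¹)⁻¹.  Finally, if π
-- avoids 312 then an entry b is preceded by a larger entry exactly when b + 1 lies left of b,
-- so the descents of π and of π⁻¹ correspond value by value; likewise for 231 (b is followed
-- by a smaller entry iff b − 1 lies right of b) and for 132, where ascents correspond (b is
-- preceded by a smaller entry iff b − 1 lies left of b).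

module Submission where

open import Defs
open import Data.Nat using (ℕ; zero; suc; _+_; _∸_; _≤_; _<_; z≤n; s≤s; z<s; _<ᵇ_; _≤ᵇ_; _≡ᵇ_)
open import Data.Nat.Properties
open import Data.Bool using (Bool; true; false; if_then_else_; not; T; _∧_)
open import Data.List using (List; []; _∷_; [_]; map; upTo; applyUpTo; reverse; length; foldr; _++_)
open import Data.List.Properties using (map-∘; map-cong-local; map-applyUpTo; reverse-involutive; reverse-map; length-reverse; unfold-reverse; length-map; length-++; ++-assoc)
open import Data.List.Membership.Propositional using (_∈_; _∉_)
open import Data.List.Membership.Propositional.Properties using (∈-map⁻; ∈-++⁺ˡ; ∈-++⁺ʳ; ∈-++⁻; ∈-∃++)
open import Data.List.Membership.DecPropositional _≟_ using (_∈?_)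
open import Data.List.Relation.Unary.Any using (here; there)
import Data.List.Relation.Unary.Any.Properties as Any
import Data.List.Relation.Unary.All as All
open import Data.List.Relation.Unary.Linked using (Linked; []; [-]; _∷_)
open import Data.List.Relation.Binary.Sublist.Propositional using (_⊆_; []; _∷_; _∷ʳ_; ⊆-trans)
import Data.List.Relation.Binary.Sublist.Propositional as Sublist
import Data.List.Relation.Binary.Sublist.Propositional.Properties as Sublist
import Data.List.Relation.Binary.Permutation.Propositional as ↭
import Data.List.Relation.Binary.Permutation.Propositional.Properties as ↭
open import Data.Product using (Σ; _×_; _,_; proj₁; proj₂; map₁; uncurry)
open import Data.Sum using (_⊎_; inj₁; inj₂)
open import Data.Empty using (⊥; ⊥-elim)
open import Data.Unit using (tt)
open import Function using (_∘_; id)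
open import Relation.Nullary using (¬_; Dec; yes; no)
open import Relation.Nullary.Reflects using (Reflects; ofʸ; ofⁿ; _×-reflects_)
open import Relation.Binary.Definitions using (tri<; tri≈; tri>)
open import Relation.Binary.PropositionalEquality using (_≡_; _≢_; refl; sym; trans; cong; cong₂; subst; subst₂; module ≡-Reasoning)

<⇒<ᵇ≡true : ∀ {m n} → m < n → (m <ᵇ n) ≡ true
<⇒<ᵇ≡true {m} {n} m<n with m <ᵇ n | <ᵇ-reflects-< m n
... | true  | _ = refl
... | false | ofⁿ m≮n = ⊥-elim (m≮n m<n)

≥⇒<ᵇ≡false : ∀ {m n} → n ≤ m → (m <ᵇ n) ≡ false
≥⇒<ᵇ≡false {m} {n} n≤m with m <ᵇ n | <ᵇ-reflects-< m n
... | false | _ = refl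
... | true  | ofʸ m<n = ⊥-elim (<⇒≱ m<n n≤m)

<ᵇ≡true⇒< : ∀ {m n} → (m <ᵇ n) ≡ true → m < n
<ᵇ≡true⇒< {m} {n} eq with m <ᵇ n | <ᵇ-reflects-< m n
<ᵇ≡true⇒< refl | true | ofʸ m<n = m<n

≤⇒≤ᵇ≡true : ∀ {m n} → m ≤ n → (m ≤ᵇ n) ≡ true
≤⇒≤ᵇ≡true {m} {n} m≤n with m ≤ᵇ n | ≤ᵇ-reflects-≤ m n
... | true  | _ = refl
... | false | ofⁿ m≰n = ⊥-elim (m≰n m≤n)

>⇒≤ᵇ≡false : ∀ {m n} → n < m → (m ≤ᵇ n) ≡ false
>⇒≤ᵇ≡false {m} {n} n<m with m ≤ᵇ n | ≤ᵇ-reflects-≤ m n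
... | false | _ = refl
... | true  | ofʸ m≤n = ⊥-elim (<⇒≱ n<m m≤n)

≡⇒≡ᵇ≡true : ∀ {m n} → m ≡ n → (m ≡ᵇ n) ≡ true
≡⇒≡ᵇ≡true {m} {n} m≡n with m ≡ᵇ n | ≡⇒≡ᵇ m n m≡n
... | true | _ = refl

≢⇒≡ᵇ≡false : ∀ {m n} → m ≢ n → (m ≡ᵇ n) ≡ false
≢⇒≡ᵇ≡false {m} {n} m≢n with m ≡ᵇ n in eq
... | false = refl
... | true  = ⊥-elim (m≢n (≡ᵇ⇒≡ m n (subst T (sym eq) tt)))

≡ᵇ≡true⇒≡ : ∀ {m n} → (m ≡ᵇ n) ≡ true → m ≡ n
≡ᵇ≡true⇒≡ {m} {n} eq = ≡ᵇ⇒≡ m n (subst T (sym eq) tt)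

≡ᵇ≡false⇒≢ : ∀ {m n} → (m ≡ᵇ n) ≡ false → m ≢ n
≡ᵇ≡false⇒≢ eq m≡n with () ← trans (sym (≡⇒≡ᵇ≡true m≡n)) eq

range : ℕ → ℕ → List ℕ
range a zero    = []
range a (suc k) = a ∷ range (suc a) k

∈-range⁻ : ∀ a k {x} → x ∈ range a k → a ≤ x × x < a + k
∈-range⁻ a (suc k) (here refl) = ≤-refl , m<m+n a z<s
∈-range⁻ a (suc k) {x} (there x∈) with ∈-range⁻ (suc a) k x∈
... | a<x , x<1+a+k = <⇒≤ a<x , subst (x <_) (sym (+-suc a k)) x<1+a+k

∈-range⁺ : ∀ a k {x} → a ≤ x → x < a + k → x ∈ range a k
∈-range⁺ a zero    a≤x x<a+0 = ⊥-elim (<⇒≱ x<a+0 (subst (_≤ _) (sym (+-identityʳ a)) a≤x))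
∈-range⁺ a (suc k) {x} a≤x x<a+k with a ≟ x
... | yes refl = here refl
... | no a≢x   = there (∈-range⁺ (suc a) k (≤∧≢⇒< a≤x a≢x) (subst (x <_) (+-suc a k) x<a+k))

∈-range1⁻ : ∀ n {x} → x ∈ range 1 n → 1 ≤ x × x ≤ n
∈-range1⁻ n x∈ with ∈-range⁻ 1 n x∈
... | 1≤x , s≤s x≤n = 1≤x , x≤n

∈-range1⁺ : ∀ n {x} → 1 ≤ x → x ≤ n → x ∈ range 1 n
∈-range1⁺ n 1≤x x≤n = ∈-range⁺ 1 n 1≤x (s≤s x≤n)

length-range : ∀ a k → length (range a k) ≡ k
length-range a zero    = refl
length-range a (suc k) = cong suc (length-range (suc a) k)

range-suc : ∀ a k → range (suc a) k ≡ map suc (range a k)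
range-suc a zero    = refl
range-suc a (suc k) = cong (suc a ∷_) (range-suc (suc a) k)

range-∷ʳ : ∀ a k → range a (suc k) ≡ range a k ++ [ a + k ]
range-∷ʳ a zero    = cong [_] (sym (+-identityʳ a))
range-∷ʳ a (suc k) =
  cong (a ∷_) (trans (range-∷ʳ (suc a) k) (cong (λ z → range (suc a) k ++ [ z ]) (sym (+-suc a k))))

applyUpTo≡map-range : ∀ (f : ℕ → ℕ) k → applyUpTo f k ≡ map f (range 0 k)
applyUpTo≡map-range f zero    = refl
applyUpTo≡map-range f (suc k) = cong (f 0 ∷_) (begin
  applyUpTo (f ∘ suc) k        ≡⟨ applyUpTo≡map-range (f ∘ suc) k ⟩
  map (f ∘ suc) (range 0 k)    ≡⟨ map-∘ (range 0 k) ⟩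
  map f (map suc (range 0 k))  ≡⟨ cong (map f) (range-suc 0 k) ⟨
  map f (range 1 k)            ∎)
  where open ≡-Reasoning

[1‥n]≡range : ∀ n → [1‥ n ] ≡ range 1 n
[1‥n]≡range n = begin
  map suc (upTo n)     ≡⟨ map-applyUpTo id suc n ⟩
  applyUpTo suc n      ≡⟨ applyUpTo≡map-range suc n ⟩
  map suc (range 0 n)  ≡⟨ range-suc 0 n ⟨
  range 1 n            ∎
  where open ≡-Reasoning

count-cong : ∀ {p q : ℕ → Bool} xs → (∀ {x} → x ∈ xs → p x ≡ q x) → count p xs ≡ count q xs
count-cong [] _ = refl
count-cong {p} {q} (x ∷ xs) p≡q rewrite p≡q (here refl) with q x
... | true  = cong suc (count-cong xs (p≡q ∘ there))
... | false = count-cong xs (p≡q ∘ there)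

count≤length : ∀ (p : ℕ → Bool) xs → count p xs ≤ length xs
count≤length p [] = z≤n
count≤length p (x ∷ xs) with p x
... | true  = s≤s (count≤length p xs)
... | false = m≤n⇒m≤1+n (count≤length p xs)

count<length : ∀ (p : ℕ → Bool) xs {x} → x ∈ xs → p x ≡ false → count p xs < length xs
count<length p (_ ∷ xs) (here refl) px≡false rewrite px≡false = s≤s (count≤length p xs)
count<length p (y ∷ xs) (there x∈) px≡false with p y
... | true  = s≤s (count<length p xs x∈ px≡false)
... | false = m≤n⇒m≤1+n (count<length p xs x∈ px≡false)

count-mono : ∀ (p q : ℕ → Bool) xs → (∀ {x} → x ∈ xs → p x ≡ true → q x ≡ true) →
             count p xs ≤ count q xs
count-mono p q [] _ = z≤n
count-mono p q (x ∷ xs) p⇒q with p x in px | q x in qx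
... | true  | true  = s≤s (count-mono p q xs (p⇒q ∘ there))
... | false | true  = m≤n⇒m≤1+n (count-mono p q xs (p⇒q ∘ there))
... | false | false = count-mono p q xs (p⇒q ∘ there)
... | true  | false with () ← trans (sym (p⇒q (here refl) px)) qx

count-mono-< : ∀ (p q : ℕ → Bool) xs → (∀ {x} → x ∈ xs → p x ≡ true → q x ≡ true) →
               ∀ {x} → x ∈ xs → p x ≡ false → q x ≡ true → count p xs < count q xs
count-mono-< p q (_ ∷ xs) p⇒q (here refl) px qx rewrite px | qx = s≤s (count-mono p q xs (p⇒q ∘ there))
count-mono-< p q (y ∷ xs) p⇒q (there x∈) px qx with p y in py | q y in qy
... | true  | true  = s≤s (count-mono-< p q xs (p⇒q ∘ there) x∈ px qx)
... | false | true  = m≤n⇒m≤1+n (count-mono-< p q xs (p⇒q ∘ there) x∈ px qx)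
... | false | false = count-mono-< p q xs (p⇒q ∘ there) x∈ px qx
... | true  | false with () ← trans (sym (p⇒q (here refl) py)) qy

count-++ : ∀ (p : ℕ → Bool) xs ys → count p (xs ++ ys) ≡ count p xs + count p ys
count-++ p [] ys = refl
count-++ p (x ∷ xs) ys with p x
... | true  = cong suc (count-++ p xs ys)
... | false = count-++ p xs ys

count-map : ∀ (p : ℕ → Bool) (f : ℕ → ℕ) xs → count p (map f xs) ≡ count (p ∘ f) xs
count-map p f [] = refl
count-map p f (x ∷ xs) with p (f x)
... | true  = cong suc (count-map p f xs)
... | false = count-map p f xs

count+count-complement : ∀ (p q : ℕ → Bool) xs → (∀ {x} → x ∈ xs → p x ≡ not (q x)) →
                         count p xs + count q xs ≡ length xs
count+count-complement p q [] _ = refl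
count+count-complement p q (x ∷ xs) p≡¬q with p x | q x | p≡¬q (here refl)
... | true  | false | _ = cong suc (count+count-complement p q xs (p≡¬q ∘ there))
... | false | true  | _ = trans (+-suc _ _) (cong suc (count+count-complement p q xs (p≡¬q ∘ there)))

data Distinct : List ℕ → Set where
  []  : Distinct []
  _∷_ : ∀ {x xs} → x ∉ xs → Distinct xs → Distinct (x ∷ xs)

∈-remove : ∀ {z x : ℕ} A B → z ∈ A ++ x ∷ B → z ≢ x → z ∈ A ++ B
∈-remove []      B (here refl) z≢x = ⊥-elim (z≢x refl)
∈-remove []      B (there z∈)  _   = z∈
∈-remove (_ ∷ A) B (here refl) _   = here refl
∈-remove (_ ∷ A) B (there z∈)  z≢x = there (∈-remove A B z∈ z≢x)

∈-insert : ∀ {z x : ℕ} A B → z ∈ A ++ B → z ∈ A ++ x ∷ B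
∈-insert []      B z∈          = there z∈
∈-insert (_ ∷ A) B (here refl) = here refl
∈-insert (_ ∷ A) B (there z∈)  = there (∈-insert A B z∈)

distinct-remove : ∀ {x} A B → Distinct (A ++ x ∷ B) → Distinct (A ++ B) × x ∉ A ++ B
distinct-remove []      B (x∉ ∷ d) = d , x∉
distinct-remove (a ∷ A) B (a∉ ∷ d) with distinct-remove A B d
... | d′ , x∉ = (a∉ ∘ ∈-insert A B) ∷ d′ ,
                λ { (here refl) → a∉ (∈-++⁺ʳ A (here refl)) ; (there x∈) → x∉ x∈ }

length-insert : ∀ {x : ℕ} A B → length (A ++ x ∷ B) ≡ suc (length (A ++ B))
length-insert []      B = refl
length-insert (_ ∷ A) B = cong suc (length-insert A B)

distinct-⊆⇒length≤ : ∀ {xs ys} → Distinct xs → (∀ {z} → z ∈ xs → z ∈ ys) → length xs ≤ length ys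
distinct-⊆⇒length≤ [] _ = z≤n
distinct-⊆⇒length≤ {x ∷ xs} (x∉ ∷ d) xs⊆ys with ∈-∃++ (xs⊆ys (here refl))
... | A , B , refl = subst (suc (length xs) ≤_) (sym (length-insert A B))
  (s≤s (distinct-⊆⇒length≤ d (λ z∈ → ∈-remove A B (xs⊆ys (there z∈)) (λ { refl → x∉ z∈ }))))

count-insert : ∀ (p : ℕ → Bool) {x} A B → count p (A ++ x ∷ B) ≡ count p (x ∷ A ++ B)
count-insert p {x} A B = begin
  count p (A ++ x ∷ B)             ≡⟨ count-++ p A (x ∷ B) ⟩
  count p A + count p (x ∷ B)      ≡⟨ move (count p A) ⟩
  count p (x ∷ []) + (count p A + count p B) ≡⟨ cong (count p (x ∷ []) +_) (count-++ p A B) ⟨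
  count p (x ∷ []) + count p (A ++ B) ≡⟨ split (A ++ B) ⟨
  count p (x ∷ A ++ B)             ∎
  where
  open ≡-Reasoning
  split : ∀ ys → count p (x ∷ ys) ≡ count p (x ∷ []) + count p ys
  split ys with p x
  ... | true  = refl
  ... | false = refl
  move : ∀ c → c + count p (x ∷ B) ≡ count p (x ∷ []) + (c + count p B)
  move c with p x
  ... | true  = +-suc c (count p B)
  ... | false = refl

count-distinct-cong : ∀ (p : ℕ → Bool) {xs ys} → Distinct xs → Distinct ys →
                      (∀ {z} → z ∈ xs → z ∈ ys) → (∀ {z} → z ∈ ys → z ∈ xs) → count p xs ≡ count p ys
count-distinct-cong p {[]}     {[]}    _ _ _ _ = refl
count-distinct-cong p {[]}     {_ ∷ _} _ _ _ ys⊆xs with () ← ys⊆xs (here refl)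
count-distinct-cong p {x ∷ xs} {ys} (x∉ ∷ dx) dy xs⊆ys ys⊆xs with ∈-∃++ (xs⊆ys (here refl))
... | A , B , refl with distinct-remove A B dy
... | dy′ , x∉′ = trans (cong (λ c → if p x then suc c else c) (count-distinct-cong p dx dy′ xs⊆AB AB⊆xs))
                        (sym (count-insert p A B))
  where
  xs⊆AB : ∀ {z} → z ∈ xs → z ∈ A ++ B
  xs⊆AB z∈ = ∈-remove A B (xs⊆ys (there z∈)) (λ { refl → x∉ z∈ })
  AB⊆xs : ∀ {z} → z ∈ A ++ B → z ∈ xs
  AB⊆xs z∈ with ys⊆xs (∈-insert A B z∈)
  ... | here refl = ⊥-elim (x∉′ z∈)
  ... | there z∈′ = z∈′

distinct-resp-↭ : ∀ {xs ys} → xs ↭.↭ ys → Distinct xs → Distinct ys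
distinct-resp-↭ ↭.refl d = d
distinct-resp-↭ (↭.prep x p) (x∉ ∷ d) = (x∉ ∘ ↭.∈-resp-↭ (↭.↭-sym p)) ∷ distinct-resp-↭ p d
distinct-resp-↭ (↭.swap x y p) (x∉ ∷ y∉ ∷ d) =
  (λ { (here refl) → x∉ (here refl) ; (there y∈) → y∉ (↭.∈-resp-↭ (↭.↭-sym p) y∈) }) ∷
  (x∉ ∘ there ∘ ↭.∈-resp-↭ (↭.↭-sym p)) ∷ distinct-resp-↭ p d
distinct-resp-↭ (↭.trans p q) d = distinct-resp-↭ q (distinct-resp-↭ p d)

distinct-reverse : ∀ {xs} → Distinct xs → Distinct (reverse xs)
distinct-reverse {xs} = distinct-resp-↭ (↭.↭-sym (↭.↭-reverse xs))

distinct-map : ∀ (f : ℕ → ℕ) {xs} → Distinct xs → (∀ {x y} → x ∈ xs → y ∈ xs → f x ≡ f y → x ≡ y) →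
               Distinct (map f xs)
distinct-map f [] _ = []
distinct-map f {x ∷ xs} (x∉ ∷ d) f-inj = fx∉ ∷ distinct-map f d (λ x∈ y∈ → f-inj (there x∈) (there y∈))
  where
  fx∉ : f x ∉ map f xs
  fx∉ fx∈ with ∈-map⁻ f fx∈
  ... | y , y∈ , fx≡fy with f-inj (here refl) (there y∈) fx≡fy
  ... | refl = x∉ y∈

distinct-range : ∀ a k → Distinct (range a k)
distinct-range a zero    = []
distinct-range a (suc k) =
  (λ a∈ → <-irrefl refl (proj₁ (∈-range⁻ (suc a) k a∈))) ∷ distinct-range (suc a) k

distinct-++⇒disjoint : ∀ {x} A B → Distinct (A ++ B) → x ∈ A → x ∉ B
distinct-++⇒disjoint (_ ∷ A) B (a∉ ∷ _) (here refl) x∈B = a∉ (∈-++⁺ʳ A x∈B)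
distinct-++⇒disjoint (_ ∷ A) B (_ ∷ d)  (there x∈)  x∈B = distinct-++⇒disjoint A B d x∈ x∈B

-- 1-based like pos; out-of-range indices give the junk value 0.
nth : ℕ → List ℕ → ℕ
nth _             []       = 0
nth zero          (_ ∷ _)  = 0
nth (suc zero)    (x ∷ _)  = x
nth (suc (suc k)) (_ ∷ xs) = nth (suc k) xs

nth-∷ : ∀ {k} x xs → 1 ≤ k → nth (suc k) (x ∷ xs) ≡ nth k xs
nth-∷ {suc k} _ _ _ = refl

pos-here : ∀ {x y} ys → y ≡ x → pos x (y ∷ ys) ≡ 1
pos-here ys y≡x rewrite ≡⇒≡ᵇ≡true y≡x = refl

pos-there : ∀ {x y} ys → y ≢ x → pos x (y ∷ ys) ≡ suc (pos x ys)
pos-there ys y≢x rewrite ≢⇒≡ᵇ≡false y≢x = refl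

pos≥1 : ∀ {x σ} → x ∈ σ → 1 ≤ pos x σ
pos≥1 {x} {y ∷ _} _ with y ≡ᵇ x
... | true  = s≤s z≤n
... | false = s≤s z≤n

pos≤length : ∀ {x σ} → x ∈ σ → pos x σ ≤ length σ
pos≤length {x} {y ∷ ys} x∈ with y ≡ᵇ x in y≡ᵇx
... | true = s≤s z≤n
pos≤length {x} {y ∷ ys} (here refl) | false = ⊥-elim (≡ᵇ≡false⇒≢ {x} y≡ᵇx refl)
pos≤length {x} {y ∷ ys} (there x∈)  | false = s≤s (pos≤length x∈)

nth-pos : ∀ {x σ} → x ∈ σ → nth (pos x σ) σ ≡ x
nth-pos {x} {y ∷ ys} x∈ with y ≡ᵇ x in y≡ᵇx
... | true = ≡ᵇ≡true⇒≡ y≡ᵇx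
nth-pos {x} {y ∷ ys} (here refl) | false = ⊥-elim (≡ᵇ≡false⇒≢ {x} y≡ᵇx refl)
nth-pos {x} {y ∷ ys} (there x∈)  | false = trans (nth-∷ y ys (pos≥1 x∈)) (nth-pos x∈)

nth∈ : ∀ k σ → 1 ≤ k → k ≤ length σ → nth k σ ∈ σ
nth∈ (suc zero)    (_ ∷ _)  _ _       = here refl
nth∈ (suc (suc k)) (_ ∷ ys) _ (s≤s k≤) = there (nth∈ (suc k) ys (s≤s z≤n) k≤)

pos-nth : ∀ k {σ} → Distinct σ → 1 ≤ k → k ≤ length σ → pos (nth k σ) σ ≡ k
pos-nth (suc zero)    {_ ∷ ys} _        _ _       = pos-here ys refl
pos-nth (suc (suc k)) {y ∷ ys} (y∉ ∷ d) _ (s≤s k≤) =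
  trans (pos-there ys (λ y≡ → y∉ (subst (_∈ ys) (sym y≡) (nth∈ (suc k) ys (s≤s z≤n) k≤))))
        (cong suc (pos-nth (suc k) d (s≤s z≤n) k≤))

pos-injective : ∀ {x y σ} → x ∈ σ → y ∈ σ → pos x σ ≡ pos y σ → x ≡ y
pos-injective {σ = σ} x∈ y∈ eq = trans (sym (nth-pos x∈)) (trans (cong (λ k → nth k σ) eq) (nth-pos y∈))

pos-there⁻ : ∀ {x y ys} → x ∈ y ∷ ys → 1 < pos x (y ∷ ys) → x ∈ ys × pos x (y ∷ ys) ≡ suc (pos x ys)
pos-there⁻ {x} {y} x∈ 1<pos with y ≡ᵇ x in y≡ᵇx
... | true = ⊥-elim (<-irrefl refl 1<pos)
pos-there⁻ {x} (here refl) 1<pos | false = ⊥-elim (≡ᵇ≡false⇒≢ {x} y≡ᵇx refl)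
pos-there⁻ (there x∈) 1<pos | false = x∈ , refl

∈-keep⁻ : ∀ (p : ℕ → Bool) xs {z} → z ∈ keep p xs → z ∈ xs × p z ≡ true
∈-keep⁻ p (x ∷ xs) z∈ with p x in px
∈-keep⁻ p (x ∷ xs) (here refl) | true = here refl , px
∈-keep⁻ p (x ∷ xs) (there z∈)  | true = map₁ there (∈-keep⁻ p xs z∈)
... | false = map₁ there (∈-keep⁻ p xs z∈)

∈-keep⁺ : ∀ (p : ℕ → Bool) xs {z} → z ∈ xs → p z ≡ true → z ∈ keep p xs
∈-keep⁺ p (x ∷ xs) (here refl) pz rewrite pz = here refl
∈-keep⁺ p (x ∷ xs) (there z∈)  pz with p x
... | true  = there (∈-keep⁺ p xs z∈ pz)
... | false = ∈-keep⁺ p xs z∈ pz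

distinct-keep : ∀ (p : ℕ → Bool) {xs} → Distinct xs → Distinct (keep p xs)
distinct-keep p [] = []
distinct-keep p {x ∷ xs} (x∉ ∷ d) with p x
... | true  = (x∉ ∘ proj₁ ∘ ∈-keep⁻ p xs) ∷ distinct-keep p d
... | false = distinct-keep p d

keep-++ : ∀ (p : ℕ → Bool) xs ys → keep p (xs ++ ys) ≡ keep p xs ++ keep p ys
keep-++ p [] ys = refl
keep-++ p (x ∷ xs) ys with p x
... | true  = cong (x ∷_) (keep-++ p xs ys)
... | false = keep-++ p xs ys

before++after⊆ : ∀ j σ {z} → z ∈ before j σ ++ after j σ → z ∈ σ
before++after⊆ j (x ∷ xs) z∈ with x ≡ᵇ j
... | true = there z∈
before++after⊆ j (x ∷ xs) (here refl) | false = here refl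
before++after⊆ j (x ∷ xs) (there z∈)  | false = there (before++after⊆ j xs z∈)

distinct-before++after : ∀ j {σ} → Distinct σ → Distinct (before j σ ++ after j σ)
distinct-before++after j [] = []
distinct-before++after j {x ∷ xs} (x∉ ∷ d) with x ≡ᵇ j
... | true  = d
... | false = (x∉ ∘ before++after⊆ j xs) ∷ distinct-before++after j d

before⊆ : ∀ j σ {z} → z ∈ before j σ → z ∈ σ
before⊆ j σ = before++after⊆ j σ ∘ ∈-++⁺ˡ

after⊆ : ∀ j σ {z} → z ∈ after j σ → z ∈ σ
after⊆ j σ = before++after⊆ j σ ∘ ∈-++⁺ʳ (before j σ)

∈-before⇒pos< : ∀ j σ {z} → j ∈ σ → z ∈ before j σ → pos z σ < pos j σ
∈-before⇒pos< j (x ∷ xs) {z} j∈ z∈ with x ≡ᵇ j in x≡ᵇj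
∈-before⇒pos< j (x ∷ xs) {z} j∈          () | true
∈-before⇒pos< j (x ∷ xs) {z} (here refl) z∈ | false = ⊥-elim (≡ᵇ≡false⇒≢ {j} x≡ᵇj refl)
∈-before⇒pos< j (x ∷ xs) {z} (there j∈)  z∈ | false with x ≡ᵇ z in x≡ᵇz
... | true = s≤s (pos≥1 j∈)
∈-before⇒pos< j (x ∷ xs) {z} (there j∈) (here refl) | false | false = ⊥-elim (≡ᵇ≡false⇒≢ {z} x≡ᵇz refl)
∈-before⇒pos< j (x ∷ xs) {z} (there j∈) (there z∈)  | false | false = s≤s (∈-before⇒pos< j xs j∈ z∈)

pos<⇒∈-before : ∀ j σ {z} → j ∈ σ → z ∈ σ → pos z σ < pos j σ → z ∈ before j σ
pos<⇒∈-before j (x ∷ xs) {z} j∈ z∈ lt with x ≡ᵇ j in x≡ᵇj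
... | true = ⊥-elim (<⇒≱ lt (pos≥1 z∈))
pos<⇒∈-before j (x ∷ xs) {z} (here refl) z∈ lt | false = ⊥-elim (≡ᵇ≡false⇒≢ {j} x≡ᵇj refl)
pos<⇒∈-before j (x ∷ xs) {z} (there j∈)  z∈ lt | false with x ≟ z
... | yes refl = here refl
... | no x≢z with z∈
... | here refl = ⊥-elim (x≢z refl)
... | there z∈′ =
  there (pos<⇒∈-before j xs j∈ z∈′ (≤-pred (subst (_< suc (pos j xs)) (pos-there xs x≢z) lt)))

∈-after⇒pos> : ∀ j {σ z} → Distinct σ → z ∈ after j σ → pos j σ < pos z σ
∈-after⇒pos> j {x ∷ xs} {z} (x∉ ∷ d) z∈ with x ≡ᵇ j
... | true  = subst (1 <_) (sym (pos-there {z} {x} xs (λ { refl → x∉ z∈ }))) (s≤s (pos≥1 z∈))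
... | false = subst (suc (pos j xs) <_) (sym (pos-there {z} {x} xs (λ { refl → x∉ (after⊆ j xs z∈) })))
                    (s≤s (∈-after⇒pos> j d z∈))

pos>⇒∈-after : ∀ j σ {z} → z ∈ σ → j ∈ σ → pos j σ < pos z σ → z ∈ after j σ
pos>⇒∈-after j (x ∷ xs) {z} z∈ j∈ lt with x ≡ᵇ j in x≡ᵇj
... | true = proj₁ (pos-there⁻ z∈ lt)
pos>⇒∈-after j (x ∷ xs) {z} z∈ (here refl) lt | false = ⊥-elim (≡ᵇ≡false⇒≢ {j} x≡ᵇj refl)
pos>⇒∈-after j (x ∷ xs) {z} z∈ (there j∈)  lt | false with pos-there⁻ z∈ (≤-<-trans (s≤s z≤n) lt)
... | z∈′ , pos≡ = pos>⇒∈-after j xs z∈′ j∈ (≤-pred (subst (suc (pos j xs) <_) pos≡ lt))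

before-∉ : ∀ j σ → j ∉ σ → before j σ ≡ σ
before-∉ j [] _ = refl
before-∉ j (x ∷ xs) j∉ with x ≡ᵇ j in x≡ᵇj
... | true  = ⊥-elim (j∉ (here (sym (≡ᵇ≡true⇒≡ x≡ᵇj))))
... | false = cong (x ∷_) (before-∉ j xs (j∉ ∘ there))

after-∉ : ∀ j σ → j ∉ σ → after j σ ≡ []
after-∉ j [] _ = refl
after-∉ j (x ∷ xs) j∉ with x ≡ᵇ j in x≡ᵇj
... | true  = ⊥-elim (j∉ (here (sym (≡ᵇ≡true⇒≡ x≡ᵇj))))
... | false = after-∉ j xs (j∉ ∘ there)

∈-there⁻ : ∀ {x w : ℕ} {σ} → x ∈ w ∷ σ → w ≢ x → x ∈ σ
∈-there⁻ (here refl) w≢x = ⊥-elim (w≢x refl)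
∈-there⁻ (there x∈)  _   = x∈

∷⊆ : ∀ {x ys} σ → x ∈ σ → ys ⊆ after x σ → x ∷ ys ⊆ σ
∷⊆ {x} (w ∷ σ) x∈ ys⊆ with w ≡ᵇ x in w≡ᵇx
... | true  = sym (≡ᵇ≡true⇒≡ w≡ᵇx) ∷ ys⊆
... | false = w ∷ʳ ∷⊆ σ (∈-there⁻ x∈ (≡ᵇ≡false⇒≢ w≡ᵇx)) ys⊆

after-after : ∀ {x y} σ → x ∈ σ → pos x σ < pos y σ → after y σ ≡ after y (after x σ)
after-after {x} {y} (w ∷ σ) x∈ x<y with w ≡ᵇ x in w≡ᵇx | w ≡ᵇ y
... | true  | true  = ⊥-elim (<-irrefl refl x<y)
... | true  | false = refl
... | false | false = after-after σ (∈-there⁻ x∈ (≡ᵇ≡false⇒≢ w≡ᵇx)) (≤-pred x<y)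
after-after (w ∷ σ) x∈ (s≤s ()) | false | true

pos-increasing⇒⊆ : ∀ {x y z σ} → x ∈ σ → y ∈ σ → z ∈ σ → pos x σ < pos y σ → pos y σ < pos z σ →
                   x ∷ y ∷ z ∷ [] ⊆ σ
pos-increasing⇒⊆ {x} {y} {z} {σ} x∈ y∈ z∈ x<y y<z =
  ∷⊆ σ x∈ (∷⊆ (after x σ) (pos>⇒∈-after x σ y∈ x∈ x<y)
    (Sublist.from∈ (subst (z ∈_) (after-after σ x∈ x<y) (pos>⇒∈-after y σ z∈ y∈ y<z))))

⊆⇒pos< : ∀ {x y : ℕ} {σ} → Distinct σ → x ∷ y ∷ [] ⊆ σ → pos x σ < pos y σ
⊆⇒pos< {x} {y} {w ∷ σ} (w∉ ∷ d) (.w ∷ʳ xy⊆) =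
  subst₂ _<_ (sym (pos-there {x} {w} σ (λ { refl → w∉ (Sublist.lookup xy⊆ (here refl)) })))
             (sym (pos-there {y} {w} σ (λ { refl → w∉ (Sublist.lookup xy⊆ (there (here refl))) })))
             (s≤s (⊆⇒pos< d xy⊆))
⊆⇒pos< {x} {y} {w ∷ σ} (w∉ ∷ d) (refl ∷ y⊆) =
  subst₂ _<_ (sym (pos-here σ refl))
             (sym (pos-there {y} {w} σ (λ { refl → w∉ (Sublist.lookup y⊆ (here refl)) })))
             (s≤s (pos≥1 (Sublist.lookup y⊆ (here refl))))

⊆-map⁻ : ∀ (f : ℕ → ℕ) {xs} σ → xs ⊆ map f σ → Σ (List ℕ) λ ys → ys ⊆ σ × map f ys ≡ xs
⊆-map⁻ f [] [] = [] , [] , refl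
⊆-map⁻ f (w ∷ σ) (_ ∷ʳ xs⊆) with ⊆-map⁻ f σ xs⊆
... | ys , ys⊆ , refl = ys , w ∷ʳ ys⊆ , refl
⊆-map⁻ f (w ∷ σ) (refl ∷ xs⊆) with ⊆-map⁻ f σ xs⊆
... | ys , ys⊆ , refl = w ∷ ys , refl ∷ ys⊆ , refl

⊆₃⇒pos< : ∀ {x y z : ℕ} {σ} → Distinct σ → x ∷ y ∷ z ∷ [] ⊆ σ → pos x σ < pos y σ × pos y σ < pos z σ
⊆₃⇒pos< {x} {y} {z} d xyz⊆ =
  ⊆⇒pos< d (⊆-trans (refl ∷ refl ∷ z ∷ʳ []) xyz⊆) , ⊆⇒pos< d (⊆-trans (x ∷ʳ refl ∷ refl ∷ []) xyz⊆)

Avoids132 Avoids231 Avoids312 : List ℕ → Set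
Avoids132 ρ = ∀ {x y z} → x ∷ y ∷ z ∷ [] ⊆ ρ → x < z → z < y → ⊥
Avoids231 ρ = ∀ {x y z} → x ∷ y ∷ z ∷ [] ⊆ ρ → z < x → x < y → ⊥
Avoids312 ρ = ∀ {x y z} → x ∷ y ∷ z ∷ [] ⊆ ρ → y < z → z < x → ⊥

Av⇒Avoids312 : ∀ {π} → Av (3 ∷ 1 ∷ 2 ∷ []) π → Avoids312 π
Av⇒Avoids312 {π} av {x} {y} {z} xyz⊆ y<z z<x = av (x ∷ y ∷ z ∷ [] , xyz⊆ , normal)
  where
  y<x = <-trans y<z z<x
  normal : normalize (x ∷ y ∷ z ∷ []) ≡ 3 ∷ 1 ∷ 2 ∷ []
  normal rewrite ≥⇒<ᵇ≡false {x} {x} ≤-refl | <⇒<ᵇ≡true y<x | <⇒<ᵇ≡true z<x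
               | ≥⇒<ᵇ≡false {x} {y} (<⇒≤ y<x) | ≥⇒<ᵇ≡false {y} {y} ≤-refl | ≥⇒<ᵇ≡false {z} {y} (<⇒≤ y<z)
               | ≥⇒<ᵇ≡false {x} {z} (<⇒≤ z<x) | <⇒<ᵇ≡true y<z | ≥⇒<ᵇ≡false {z} {z} ≤-refl = refl

Av⇒Avoids132 : ∀ {π} → Av (1 ∷ 3 ∷ 2 ∷ []) π → Avoids132 π
Av⇒Avoids132 {π} av {x} {y} {z} xyz⊆ x<z z<y = av (x ∷ y ∷ z ∷ [] , xyz⊆ , normal)
  where
  x<y = <-trans x<z z<y
  normal : normalize (x ∷ y ∷ z ∷ []) ≡ 1 ∷ 3 ∷ 2 ∷ []
  normal rewrite ≥⇒<ᵇ≡false {x} {x} ≤-refl | ≥⇒<ᵇ≡false {y} {x} (<⇒≤ x<y) | ≥⇒<ᵇ≡false {z} {x} (<⇒≤ x<z)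
               | <⇒<ᵇ≡true x<y | ≥⇒<ᵇ≡false {y} {y} ≤-refl | <⇒<ᵇ≡true z<y
               | <⇒<ᵇ≡true x<z | ≥⇒<ᵇ≡false {y} {z} (<⇒≤ z<y) | ≥⇒<ᵇ≡false {z} {z} ≤-refl = refl

Avoids132⇒reverse-Avoids231 : ∀ {ρ} → Avoids132 ρ → Avoids231 (reverse ρ)
Avoids132⇒reverse-Avoids231 {ρ} av {x} {y} {z} xyz⊆ z<x x<y =
  av (subst (z ∷ y ∷ x ∷ [] ⊆_) (reverse-involutive ρ) (Sublist.reverse⁺ xyz⊆)) z<x x<y

-- Permutations and their inverses

record Perm (n : ℕ) (σ : List ℕ) : Set where
  field
    distinct : Distinct σ
    bounded  : ∀ {x} → x ∈ σ → 1 ≤ x × x ≤ n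
    length≡  : length σ ≡ n

open Perm

IsPerm⇒Perm : ∀ {n π} → IsPerm n π → Perm n π
IsPerm⇒Perm {n} {π} π↭ = record
  { distinct = distinct-resp-↭ (↭.↭-sym π↭′) (distinct-range 1 n)
  ; bounded  = ∈-range1⁻ n ∘ ↭.∈-resp-↭ π↭′
  ; length≡  = trans (↭.↭-length π↭′) (length-range 1 n)
  }
  where
  π↭′ = subst (π ↭.↭_) ([1‥n]≡range n) π↭

perm⊆range : ∀ {n σ z} → Perm n σ → z ∈ σ → z ∈ range 1 n
perm⊆range {n} pm = uncurry (∈-range1⁺ n) ∘ bounded pm

∈-perm : ∀ {n σ j} → Perm n σ → 1 ≤ j → j ≤ n → j ∈ σ
∈-perm {n} {σ} {j} pm 1≤j j≤n with j ∈? σ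
... | yes j∈ = j∈
... | no  j∉ = ⊥-elim (<-irrefl refl (subst₂ _≤_ (cong suc (length≡ pm)) (length-range 1 n)
                 (distinct-⊆⇒length≤ (j∉ ∷ distinct pm) λ { (here refl) → ∈-range1⁺ n 1≤j j≤n
                                                            ; (there z∈) → perm⊆range pm z∈ })))

range⊆perm : ∀ {n σ z} → Perm n σ → z ∈ range 1 n → z ∈ σ
range⊆perm {n} pm = uncurry (∈-perm pm) ∘ ∈-range1⁻ n

count-perm : ∀ (p : ℕ → Bool) {n σ} → Perm n σ → count p σ ≡ count p (range 1 n)
count-perm p {n} pm = count-distinct-cong p (distinct pm) (distinct-range 1 n) (perm⊆range pm) (range⊆perm pm)

perm-range : ∀ n → Perm n (range 1 n)
perm-range n = record { distinct = distinct-range 1 n ; bounded = ∈-range1⁻ n ; length≡ = length-range 1 n }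

perm-reverse : ∀ {n σ} → Perm n σ → Perm n (reverse σ)
perm-reverse {n} {σ} pm = record
  { distinct = distinct-reverse (distinct pm)
  ; bounded  = bounded pm ∘ Any.reverse⁻
  ; length≡  = trans (length-reverse σ) (length≡ pm)
  }

perm-map : ∀ {n σ} (f : ℕ → ℕ) → Perm n σ → (∀ {x y} → x ∈ σ → y ∈ σ → f x ≡ f y → x ≡ y) →
           (∀ {x} → x ∈ σ → 1 ≤ f x × f x ≤ n) → Perm n (map f σ)
perm-map {n} {σ} f pm f-inj f-bounded = record
  { distinct = distinct-map f (distinct pm) f-inj
  ; bounded  = bounded′
  ; length≡  = trans (length-map f σ) (length≡ pm)
  }
  where
  bounded′ : ∀ {y} → y ∈ map f σ → 1 ≤ y × y ≤ n
  bounded′ y∈ with ∈-map⁻ f y∈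
  ... | x , x∈ , refl = f-bounded x∈

tabulate-nth : ∀ {n} σ → length σ ≡ n → σ ≡ map (λ k → nth k σ) (range 1 n)
tabulate-nth []       refl = refl
tabulate-nth (x ∷ xs) refl = cong (x ∷_) (begin
  xs                                                     ≡⟨ tabulate-nth xs refl ⟩
  map (λ k → nth k xs) (range 1 (length xs))             ≡⟨ map-cong-local (All.tabulate shift) ⟩
  map (λ k → nth (suc k) (x ∷ xs)) (range 1 (length xs)) ≡⟨ map-∘ (range 1 (length xs)) ⟩
  map (λ k → nth k (x ∷ xs)) (map suc (range 1 (length xs)))
    ≡⟨ cong (map (λ k → nth k (x ∷ xs))) (range-suc 1 (length xs)) ⟨
  map (λ k → nth k (x ∷ xs)) (range 2 (length xs))       ∎)
  where
  open ≡-Reasoning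
  shift : ∀ {k} → k ∈ range 1 (length xs) → nth k xs ≡ nth (suc k) (x ∷ xs)
  shift k∈ = sym (nth-∷ x xs (proj₁ (∈-range⁻ 1 (length xs) k∈)))

nth-map-range : ∀ (g : ℕ → ℕ) k m → 1 ≤ m → m ≤ k → nth m (map g (range 1 k)) ≡ g m
nth-map-range g (suc k) (suc zero)    _ _ = refl
nth-map-range g (suc k) (suc (suc m)) _ (s≤s m≤k)
  rewrite range-suc 1 k | sym (map-∘ {g = g} {f = suc} (range 1 k)) =
  nth-map-range (g ∘ suc) k (suc m) (s≤s z≤n) m≤k

inv≡map-pos : ∀ {n} σ → length σ ≡ n → inv σ ≡ map (λ j → pos j σ) (range 1 n)
inv≡map-pos σ refl = cong (map (λ j → pos j σ)) ([1‥n]≡range (length σ))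

nth∈perm : ∀ {n σ k} → Perm n σ → 1 ≤ k → k ≤ n → nth k σ ∈ σ
nth∈perm {σ = σ} {k} pm 1≤k k≤n = nth∈ k σ 1≤k (subst (k ≤_) (sym (length≡ pm)) k≤n)

pos-nth-perm : ∀ {n σ k} → Perm n σ → 1 ≤ k → k ≤ n → pos (nth k σ) σ ≡ k
pos-nth-perm {k = k} pm 1≤k k≤n = pos-nth k (distinct pm) 1≤k (subst (k ≤_) (sym (length≡ pm)) k≤n)

pos≤n-perm : ∀ {n σ b} → Perm n σ → b ∈ σ → pos b σ ≤ n
pos≤n-perm pm b∈ = subst (_ ≤_) (length≡ pm) (pos≤length b∈)

perm-inv : ∀ {n σ} → Perm n σ → Perm n (inv σ)
perm-inv {n} {σ} pm rewrite inv≡map-pos σ (length≡ pm) =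
  perm-map (λ j → pos j σ) (perm-range n)
    (λ x∈ y∈ → pos-injective (range⊆perm pm x∈) (range⊆perm pm y∈))
    (λ j∈ → pos≥1 (range⊆perm pm j∈) , pos≤n-perm pm (range⊆perm pm j∈))

nth-inv : ∀ {n σ m} → Perm n σ → 1 ≤ m → m ≤ n → nth m (inv σ) ≡ pos m σ
nth-inv {n} {σ} {m} pm 1≤m m≤n =
  trans (cong (nth m) (inv≡map-pos σ (length≡ pm))) (nth-map-range (λ j → pos j σ) n m 1≤m m≤n)

pos-inv : ∀ {n σ k} → Perm n σ → 1 ≤ k → k ≤ n → pos k (inv σ) ≡ nth k σ
pos-inv {n} {σ} {k} pm 1≤k k≤n = begin
  pos k (inv σ)                ≡⟨ cong (λ j → pos j (inv σ)) nth-inv-m ⟨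
  pos (nth m (inv σ)) (inv σ)  ≡⟨ pos-nth-perm (perm-inv pm) 1≤m m≤n ⟩
  m                            ∎
  where
  open ≡-Reasoning
  m = nth k σ
  1≤m = proj₁ (bounded pm (nth∈perm pm 1≤k k≤n))
  m≤n = proj₂ (bounded pm (nth∈perm pm 1≤k k≤n))
  nth-inv-m : nth m (inv σ) ≡ k
  nth-inv-m = trans (nth-inv pm 1≤m m≤n) (pos-nth-perm pm 1≤k k≤n)

inv-involutive : ∀ {n σ} → Perm n σ → inv (inv σ) ≡ σ
inv-involutive {n} {σ} pm = begin
  inv (inv σ)                            ≡⟨ inv≡map-pos (inv σ) (length≡ (perm-inv pm)) ⟩
  map (λ k → pos k (inv σ)) (range 1 n)  ≡⟨ map-cong-local (All.tabulate (uncurry (pos-inv pm) ∘ ∈-range1⁻ n)) ⟩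
  map (λ k → nth k σ) (range 1 n)        ≡⟨ tabulate-nth σ (length≡ pm) ⟨
  σ                                      ∎
  where open ≡-Reasoning

-- Descents

PreservesOrder : (ℕ → ℕ) → ℕ → ℕ → Set
PreservesOrder g x y = (x < y → g x < g y) × (y < x → g y < g x)

preservesOrder⇒injective : ∀ {g x y} → PreservesOrder g x y → g x ≡ g y → x ≡ y
preservesOrder⇒injective {x = x} {y} (x<y⇒ , y<x⇒) gx≡gy with <-cmp x y
... | tri< x<y _ _ = ⊥-elim (<-irrefl gx≡gy (x<y⇒ x<y))
... | tri≈ _ x≡y _ = x≡y
... | tri> _ _ y<x = ⊥-elim (<-irrefl (sym gx≡gy) (y<x⇒ y<x))

preservesOrder⇒reflects< : ∀ {g x y} → PreservesOrder g x y → g x < g y → x < y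
preservesOrder⇒reflects< {x = x} {y} (_ , y<x⇒) gx<gy with <-cmp x y
... | tri< x<y _ _ = x<y
... | tri≈ _ refl _ = ⊥-elim (<-irrefl refl gx<gy)
... | tri> _ _ y<x = ⊥-elim (<-asym gx<gy (y<x⇒ y<x))

linked-by-pos : ∀ (R : ℕ → ℕ → Set) {σ} → Distinct σ →
                (∀ {x y} → x ∈ σ → y ∈ σ → pos y σ ≡ suc (pos x σ) → R x y) → Linked R σ
linked-by-pos R [] _ = []
linked-by-pos R (_ ∷ []) _ = [-]
linked-by-pos R {x ∷ y ∷ σ} (x∉ ∷ d) adjacent⇒R =
  adjacent⇒R (here refl) (there (here refl)) pos-y ∷
  linked-by-pos R d (λ a∈ b∈ pos-b → adjacent⇒R (there a∈) (there b∈) (shift a∈ b∈ pos-b))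
  where
  pos-y : pos y (x ∷ y ∷ σ) ≡ suc (pos x (x ∷ y ∷ σ))
  pos-y rewrite pos-there {y} {x} (y ∷ σ) (λ { refl → x∉ (here refl) })
              | pos-here {y} σ refl | pos-here {x} (y ∷ σ) refl = refl
  shift : ∀ {a b} → a ∈ y ∷ σ → b ∈ y ∷ σ → pos b (y ∷ σ) ≡ suc (pos a (y ∷ σ)) →
          pos b (x ∷ y ∷ σ) ≡ suc (pos a (x ∷ y ∷ σ))
  shift {a} {b} a∈ b∈ pos-b rewrite pos-there {b} {x} (y ∷ σ) (λ { refl → x∉ b∈ })
                                  | pos-there {a} {x} (y ∷ σ) (λ { refl → x∉ a∈ }) = cong suc pos-b

linked-∷ʳ : ∀ {R : ℕ → ℕ → Set} xs {y z} → Linked R (xs ++ [ y ]) → R y z → Linked R (xs ++ y ∷ z ∷ [])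
linked-∷ʳ []           _               Ryz = Ryz ∷ [-]
linked-∷ʳ (_ ∷ [])     (Rxy ∷ _)       Ryz = Rxy ∷ Ryz ∷ [-]
linked-∷ʳ (_ ∷ w ∷ xs) (Rxw ∷ linked)  Ryz = Rxw ∷ linked-∷ʳ (w ∷ xs) linked Ryz

linked-reverse : ∀ {R : ℕ → ℕ → Set} → (∀ {x y} → R x y → R y x) →
                 ∀ {xs} → Linked R xs → Linked R (reverse xs)
linked-reverse sym-R {[]}     _      = []
linked-reverse {R} sym-R {x ∷ xs} linked rewrite unfold-reverse x xs = reverse-onto x xs linked
  where
  reverse-onto : ∀ x xs → Linked R (x ∷ xs) → Linked R (reverse xs ++ [ x ])
  reverse-onto x []       _              = [-]
  reverse-onto x (y ∷ ys) (Rxy ∷ linked) rewrite unfold-reverse y ys | ++-assoc (reverse ys) [ y ] [ x ] =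
    linked-∷ʳ (reverse ys) (reverse-onto y ys linked) (sym-R Rxy)

preservesOrder⇒<ᵇ≡ : ∀ {g x y} → x ≢ y → PreservesOrder g x y → (g y <ᵇ g x) ≡ (y <ᵇ x)
preservesOrder⇒<ᵇ≡ {x = x} {y} x≢y (x<y⇒ , y<x⇒) with <-cmp y x
... | tri< y<x _ _ = trans (<⇒<ᵇ≡true (y<x⇒ y<x)) (sym (<⇒<ᵇ≡true y<x))
... | tri≈ _ y≡x _ = ⊥-elim (x≢y (sym y≡x))
... | tri> _ _ x<y = trans (≥⇒<ᵇ≡false (<⇒≤ (x<y⇒ x<y))) (sym (≥⇒<ᵇ≡false (<⇒≤ x<y)))

desFrom-map : ∀ (g : ℕ → ℕ) k {σ} → Distinct σ → Linked (PreservesOrder g) σ →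
              desFrom k (map g σ) ≡ desFrom k σ
desFrom-map g k [] _ = refl
desFrom-map g k (_ ∷ []) _ = refl
desFrom-map g k {x ∷ y ∷ σ} (x∉ ∷ d) (order ∷ linked)
  rewrite preservesOrder⇒<ᵇ≡ (λ { refl → x∉ (here refl) }) order with y <ᵇ x
... | true  = cong (k ∷_) (desFrom-map g (suc k) d linked)
... | false = desFrom-map g (suc k) d linked

des-map-range : ∀ (g : ℕ → ℕ) m → des (map g (range 1 (suc m))) ≡ count (λ k → g (suc k) <ᵇ g k) (range 1 m)
des-map-range g = go 1 1
  where
  go : ∀ k a m → length (desFrom k (map g (range a (suc m)))) ≡ count (λ j → g (suc j) <ᵇ g j) (range a m)
  go k a zero = refl
  go k a (suc m) with g (suc a) <ᵇ g a
  ... | true  = cong suc (go (suc k) (suc a) m)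
  ... | false = go (suc k) (suc a) m

des≡count : ∀ {m} σ → length σ ≡ suc m → des σ ≡ count (λ k → nth (suc k) σ <ᵇ nth k σ) (range 1 m)
des≡count {m} σ len = trans (cong des (tabulate-nth σ len)) (des-map-range (λ k → nth k σ) m)

des-inv≡count : ∀ {m} σ → length σ ≡ suc m →
                des (inv σ) ≡ count (λ k → pos (suc k) σ <ᵇ pos k σ) (range 1 m)
des-inv≡count {m} σ len = trans (cong des (inv≡map-pos σ len)) (des-map-range (λ j → pos j σ) m)

count-range-shiftʳ : ∀ (P : ℕ → ℕ → Bool) m →
  count (λ k → P k (suc k)) (range 1 m) ≡ count (λ j → (1 <ᵇ j) ∧ P (j ∸ 1) j) (range 1 (suc m))
count-range-shiftʳ P m = begin
  count (λ k → P k (suc k)) (range 1 m)      ≡⟨ count-cong (range 1 m) 1<suc ⟨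
  count (Q ∘ suc) (range 1 m)                ≡⟨ count-map Q suc (range 1 m) ⟨
  count Q (map suc (range 1 m))              ≡⟨ cong (count Q) (range-suc 1 m) ⟨
  count Q (range 1 (suc m))                  ∎
  where
  open ≡-Reasoning
  Q : ℕ → Bool
  Q j = (1 <ᵇ j) ∧ P (j ∸ 1) j
  1<suc : ∀ {k} → k ∈ range 1 m → Q (suc k) ≡ P k (suc k)
  1<suc {k} k∈ = cong (_∧ P k (suc k)) (<⇒<ᵇ≡true (s≤s (proj₁ (∈-range⁻ 1 m k∈))))

count-range-shiftˡ : ∀ (P : ℕ → ℕ → Bool) m →
  count (λ k → P k (suc k)) (range 1 m) ≡ count (λ j → (j <ᵇ suc m) ∧ P j (suc j)) (range 1 (suc m))
count-range-shiftˡ P m = begin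
  count (λ k → P k (suc k)) (range 1 m)      ≡⟨ count-cong (range 1 m) below-suc-m ⟨
  count Q (range 1 m)                        ≡⟨ +-identityʳ _ ⟨
  count Q (range 1 m) + 0                    ≡⟨ cong (count Q (range 1 m) +_) last ⟨
  count Q (range 1 m) + count Q [ suc m ]    ≡⟨ count-++ Q (range 1 m) [ suc m ] ⟨
  count Q (range 1 m ++ [ suc m ])           ≡⟨ cong (count Q) (range-∷ʳ 1 m) ⟨
  count Q (range 1 (suc m))                  ∎
  where
  open ≡-Reasoning
  Q : ℕ → Bool
  Q j = (j <ᵇ suc m) ∧ P j (suc j)
  below-suc-m : ∀ {k} → k ∈ range 1 m → Q k ≡ P k (suc k)
  below-suc-m {k} k∈ = cong (_∧ P k (suc k)) (<⇒<ᵇ≡true (proj₂ (∈-range⁻ 1 m k∈)))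
  last : count Q [ suc m ] ≡ 0
  last rewrite ≥⇒<ᵇ≡false {suc m} {suc m} ≤-refl = refl

count-by-value : ∀ {n ρ} → Perm n ρ → ∀ (Q : ℕ → Bool) →
                 count Q (range 1 n) ≡ count (λ b → Q (pos b ρ)) (range 1 n)
count-by-value {n} {ρ} pm Q = begin
  count Q (range 1 n)                                          ≡⟨ count-cong (range 1 n) pos-nth-range ⟨
  count (λ k → Q (pos (nth k ρ) ρ)) (range 1 n)                ≡⟨ count-map (Q ∘ pos-in-ρ) (λ k → nth k ρ) (range 1 n) ⟨
  count (Q ∘ pos-in-ρ) (map (λ k → nth k ρ) (range 1 n))      ≡⟨ cong (count (Q ∘ pos-in-ρ)) (tabulate-nth ρ (length≡ pm)) ⟨
  count (Q ∘ pos-in-ρ) ρ                                       ≡⟨ count-perm (Q ∘ pos-in-ρ) pm ⟩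
  count (Q ∘ pos-in-ρ) (range 1 n)                             ∎
  where
  open ≡-Reasoning
  pos-in-ρ : ℕ → ℕ
  pos-in-ρ b = pos b ρ
  pos-nth-range : ∀ {k} → k ∈ range 1 n → Q (pos (nth k ρ) ρ) ≡ Q k
  pos-nth-range k∈ = cong Q (uncurry (pos-nth-perm pm) (∈-range1⁻ n k∈))

count-adjacent-by-right-entry : ∀ {m ρ} → Perm (suc m) ρ → ∀ (P : ℕ → ℕ → Bool) →
  count (λ k → P k (suc k)) (range 1 m) ≡ count (λ b → (1 <ᵇ pos b ρ) ∧ P (pos b ρ ∸ 1) (pos b ρ)) (range 1 (suc m))
count-adjacent-by-right-entry {m} pm P =
  trans (count-range-shiftʳ P m) (count-by-value pm (λ j → (1 <ᵇ j) ∧ P (j ∸ 1) j))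

count-adjacent-by-left-entry : ∀ {m ρ} → Perm (suc m) ρ → ∀ (P : ℕ → ℕ → Bool) →
  count (λ k → P k (suc k)) (range 1 m) ≡ count (λ b → (pos b ρ <ᵇ suc m) ∧ P (pos b ρ) (suc (pos b ρ))) (range 1 (suc m))
count-adjacent-by-left-entry {m} pm P =
  trans (count-range-shiftˡ P m) (count-by-value pm (λ j → (j <ᵇ suc m) ∧ P j (suc j)))

<ᵇ-flip : ∀ {x y} → x ≢ y → (y <ᵇ x) ≡ not (x <ᵇ y)
<ᵇ-flip {x} {y} x≢y with <-cmp x y
... | tri< x<y _ _ rewrite <⇒<ᵇ≡true x<y | ≥⇒<ᵇ≡false {y} {x} (<⇒≤ x<y) = refl
... | tri≈ _ x≡y _ = ⊥-elim (x≢y x≡y)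
... | tri> _ _ y<x rewrite <⇒<ᵇ≡true y<x | ≥⇒<ᵇ≡false {x} {y} (<⇒≤ y<x) = refl

descents+ascents : ∀ (g : ℕ → ℕ) m → (∀ {k} → k ∈ range 1 m → g k ≢ g (suc k)) →
  count (λ k → g (suc k) <ᵇ g k) (range 1 m) + count (λ k → g k <ᵇ g (suc k)) (range 1 m) ≡ m
descents+ascents g m injective-on-range =
  trans (count+count-complement _ _ (range 1 m) (<ᵇ-flip ∘ injective-on-range)) (length-range 1 m)

-- The sliding operators swuᵢ and swdᵢ

anyB≡true⇒∈ : ∀ x ys → anyB (x ≡ᵇ_) ys ≡ true → x ∈ ys
anyB≡true⇒∈ x (y ∷ ys) eq with x ≡ᵇ y in x≡ᵇy
... | true  = here (≡ᵇ≡true⇒≡ x≡ᵇy)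
... | false = there (anyB≡true⇒∈ x ys eq)

∈⇒anyB≡true : ∀ {x} ys → x ∈ ys → anyB (x ≡ᵇ_) ys ≡ true
∈⇒anyB≡true {x} (y ∷ ys) x∈ with x ≡ᵇ y in x≡ᵇy
... | true = refl
∈⇒anyB≡true {x} (y ∷ ys) (here refl) | false = ⊥-elim (≡ᵇ≡false⇒≢ {x} x≡ᵇy refl)
∈⇒anyB≡true {x} (y ∷ ys) (there x∈)  | false = ∈⇒anyB≡true ys x∈

∉⇒anyB≡false : ∀ {x} ys → x ∉ ys → anyB (x ≡ᵇ_) ys ≡ false
∉⇒anyB≡false {x} ys x∉ with anyB (x ≡ᵇ_) ys in eq
... | true  = ⊥-elim (x∉ (anyB≡true⇒∈ x ys eq))
... | false = refl

slide : ℕ → List ℕ → ℕ → ℕ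
slide i π x = if i ≤ᵇ x then x
              else if anyB (x ≡ᵇ_) (Rset i π)
                   then suc (count (_<ᵇ x) (Rset i π))
                   else i ∸ suc (count (x <ᵇ_) (Lset i π))

swuᵢ≡map-slide : ∀ i π → swuᵢ i π ≡ map (slide i π) π
swuᵢ≡map-slide i π = refl

module Slide (i : ℕ) (σ : List ℕ) (d : Distinct σ) (positive : ∀ {x} → x ∈ σ → 1 ≤ x) (1≤i : 1 ≤ i) where

  L R : List ℕ
  L = Lset i σ
  R = Rset i σ

  f : ℕ → ℕ
  f = slide i σ

  distinct-L++R : Distinct (L ++ R)
  distinct-L++R = subst Distinct (keep-++ (_<ᵇ i) (before i σ) (after i σ))
                                 (distinct-keep (_<ᵇ i) (distinct-before++after i d))

  ∈L⁻ : ∀ {z} → z ∈ L → z ∈ σ × z < i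
  ∈L⁻ z∈ with ∈-keep⁻ (_<ᵇ i) (before i σ) z∈
  ... | z∈′ , z<i = before⊆ i σ z∈′ , <ᵇ≡true⇒< z<i

  ∈R⁻ : ∀ {z} → z ∈ R → z ∈ σ × z < i
  ∈R⁻ z∈ with ∈-keep⁻ (_<ᵇ i) (after i σ) z∈
  ... | z∈′ , z<i = after⊆ i σ z∈′ , <ᵇ≡true⇒< z<i

  |L|+|R|≤i∸1 : length L + length R ≤ i ∸ 1
  |L|+|R|≤i∸1 = subst₂ _≤_ (length-++ L) (length-range 1 (i ∸ 1)) (distinct-⊆⇒length≤ distinct-L++R L++R⊆)
    where
    below-i : ∀ {z} → z ∈ σ × z < i → z ∈ range 1 (i ∸ 1)
    below-i (z∈ , z<i) = ∈-range⁺ 1 (i ∸ 1) (positive z∈) (subst (_ <_) (sym (m+[n∸m]≡n 1≤i)) z<i)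
    L++R⊆ : ∀ {z} → z ∈ L ++ R → z ∈ range 1 (i ∸ 1)
    L++R⊆ z∈ with ∈-++⁻ L z∈
    ... | inj₁ z∈L = below-i (∈L⁻ z∈L)
    ... | inj₂ z∈R = below-i (∈R⁻ z∈R)

  ∈L⇒∉R : ∀ {z} → z ∈ L → z ∉ R
  ∈L⇒∉R = distinct-++⇒disjoint L R distinct-L++R

  ∈L⁺ : ∀ {z} → z ∈ σ → z < i → i ∈ σ → pos z σ < pos i σ → z ∈ L
  ∈L⁺ z∈ z<i i∈ z<ᵢ = ∈-keep⁺ (_<ᵇ i) (before i σ) (pos<⇒∈-before i σ i∈ z∈ z<ᵢ) (<⇒<ᵇ≡true z<i)

  ∈R⁺ : ∀ {z} → z ∈ σ → z < i → i ∈ σ → pos i σ < pos z σ → z ∈ R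
  ∈R⁺ z∈ z<i i∈ i<z = ∈-keep⁺ (_<ᵇ i) (after i σ) (pos>⇒∈-after i σ z∈ i∈ i<z) (<⇒<ᵇ≡true z<i)

  ∈L-without-i : ∀ {z} → z ∈ σ → z < i → i ∉ σ → z ∈ L
  ∈L-without-i {z} z∈ z<i i∉ =
    ∈-keep⁺ (_<ᵇ i) (before i σ) (subst (z ∈_) (sym (before-∉ i σ i∉)) z∈) (<⇒<ᵇ≡true z<i)

  ∈R⇒right-of-i : ∀ {z} → z ∈ R → i ∈ σ × pos i σ < pos z σ
  ∈R⇒right-of-i {z} z∈ with ∈-keep⁻ (_<ᵇ i) (after i σ) z∈ | i ∈? σ
  ... | z∈′ , _ | yes i∈ = i∈ , ∈-after⇒pos> i d z∈′
  ... | z∈′ , _ | no  i∉ with () ← subst (z ∈_) (after-∉ i σ i∉) z∈′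

  ∈L⇒left-of-i : ∀ {z} → z ∈ L → i ∈ σ → pos z σ < pos i σ
  ∈L⇒left-of-i z∈ i∈ = ∈-before⇒pos< i σ i∈ (proj₁ (∈-keep⁻ (_<ᵇ i) (before i σ) z∈))

  ∈L⊎∈R : ∀ {z} → z ∈ σ → z < i → z ∈ L ⊎ z ∈ R
  ∈L⊎∈R z∈ z<i with i ∈? σ
  ... | no  i∉ = inj₁ (∈L-without-i z∈ z<i i∉)
  ... | yes i∈ with <-cmp (pos _ σ) (pos i σ)
  ... | tri< z<ᵢ _ _ = inj₁ (∈L⁺ z∈ z<i i∈ z<ᵢ)
  ... | tri≈ _ z≡ᵢ _ = ⊥-elim (<-irrefl (pos-injective z∈ i∈ z≡ᵢ) z<i)
  ... | tri> _ _ i<z = inj₂ (∈R⁺ z∈ z<i i∈ i<z)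

  f-≥ : ∀ {x} → i ≤ x → f x ≡ x
  f-≥ i≤x rewrite ≤⇒≤ᵇ≡true i≤x = refl

  f-R : ∀ {x} → x ∈ R → f x ≡ suc (count (_<ᵇ x) R)
  f-R {x} x∈ rewrite >⇒≤ᵇ≡false (proj₂ (∈R⁻ x∈)) | ∈⇒anyB≡true R x∈ = refl

  f-L : ∀ {x} → x ∈ L → f x ≡ i ∸ suc (count (x <ᵇ_) L)
  f-L {x} x∈ rewrite >⇒≤ᵇ≡false (proj₂ (∈L⁻ x∈)) | ∉⇒anyB≡false R (∈L⇒∉R x∈) = refl

  i∸1<i : i ∸ 1 < i
  i∸1<i = ∸-monoʳ-< {i} {1} {0} z<s 1≤i

  f-R≤|R| : ∀ {x} → x ∈ R → f x ≤ length R
  f-R≤|R| {x} x∈ rewrite f-R x∈ = count<length (_<ᵇ x) R x∈ (≥⇒<ᵇ≡false {x} ≤-refl)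

  count-L<|L| : ∀ {x} → x ∈ L → count (x <ᵇ_) L < length L
  count-L<|L| {x} x∈ = count<length (x <ᵇ_) L x∈ (≥⇒<ᵇ≡false {x} ≤-refl)

  |R|<f-L : ∀ {x} → x ∈ L → length R < f x
  |R|<f-L {x} x∈ rewrite f-L x∈ = m+n≤o⇒m≤o∸n (suc (length R)) (begin
    suc (length R + suc (count (x <ᵇ_) L)) ≤⟨ s≤s (+-monoʳ-≤ (length R) (count-L<|L| x∈)) ⟩
    suc (length R + length L)               ≡⟨ cong suc (+-comm (length R) (length L)) ⟩
    suc (length L + length R)               ≤⟨ s≤s |L|+|R|≤i∸1 ⟩
    suc (i ∸ 1)                             ≤⟨ i∸1<i ⟩
    i                                       ∎)
    where open ≤-Reasoning

  f-L<i : ∀ {x} → x ∈ L → f x < i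
  f-L<i {x} x∈ rewrite f-L x∈ = ≤-<-trans (∸-monoʳ-≤ i (s≤s z≤n)) i∸1<i

  f-R<i : ∀ {x} → x ∈ R → f x < i
  f-R<i x∈ = ≤-<-trans (≤-trans (f-R≤|R| x∈) (≤-trans (m≤n+m (length R) (length L)) |L|+|R|≤i∸1)) i∸1<i

  f<i : ∀ {x} → x ∈ σ → x < i → f x < i
  f<i x∈ x<i with ∈L⊎∈R x∈ x<i
  ... | inj₁ x∈L = f-L<i x∈L
  ... | inj₂ x∈R = f-R<i x∈R

  f≥1 : ∀ {x} → x ∈ σ → 1 ≤ f x
  f≥1 {x} x∈ with i ≤? x
  ... | yes i≤x = subst (1 ≤_) (sym (f-≥ i≤x)) (positive x∈)
  ... | no  i≰x with ∈L⊎∈R x∈ (≰⇒> i≰x)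
  ... | inj₁ x∈L = ≤-trans (s≤s z≤n) (|R|<f-L x∈L)
  ... | inj₂ x∈R rewrite f-R x∈R = s≤s z≤n

  f-mono-R : ∀ {x y} → x ∈ R → y ∈ R → x < y → f x < f y
  f-mono-R {x} {y} x∈ y∈ x<y rewrite f-R x∈ | f-R y∈ =
    s≤s (count-mono-< (_<ᵇ x) (_<ᵇ y) R (λ {z} _ z<x → <⇒<ᵇ≡true (<-trans (<ᵇ≡true⇒< {z} z<x) x<y))
                      x∈ (≥⇒<ᵇ≡false {x} ≤-refl) (<⇒<ᵇ≡true x<y))

  f-mono-L : ∀ {x y} → x ∈ L → y ∈ L → x < y → f x < f y
  f-mono-L {x} {y} x∈ y∈ x<y rewrite f-L x∈ | f-L y∈ =
    ∸-monoʳ-< (s≤s (count-mono-< (y <ᵇ_) (x <ᵇ_) L (λ {z} _ y<z → <⇒<ᵇ≡true (<-trans x<y (<ᵇ≡true⇒< {y} {z} y<z)))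
                                 y∈ (≥⇒<ᵇ≡false {y} ≤-refl) (<⇒<ᵇ≡true x<y)))
              (≤-trans (count-L<|L| x∈) (≤-trans (m≤m+n (length L) (length R)) (≤-trans |L|+|R|≤i∸1 (<⇒≤ i∸1<i))))

  f-reflects-<-above-i : ∀ {x y} → x ∈ σ → i ≤ y → f x < y → x < y
  f-reflects-<-above-i {x} x∈ i≤y fx<y with i ≤? x
  ... | yes i≤x = subst (_< _) (f-≥ i≤x) fx<y
  ... | no  i≰x = <-≤-trans (≰⇒> i≰x) i≤y

  f-R<f-L : ∀ {x y} → x ∈ L → y ∈ R → f y < f x
  f-R<f-L x∈ y∈ = ≤-<-trans (f-R≤|R| y∈) (|R|<f-L x∈)

  -- Only a pair split by i can change its relative order under f.
  Straddle : ℕ → ℕ → Set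
  Straddle x y = (x ∈ L × y ∈ R) ⊎ (x ∈ R × y ∈ L)

  f-preserves-order : ∀ {x y} → x ∈ σ → y ∈ σ → ¬ Straddle x y → PreservesOrder f x y
  f-preserves-order {x} {y} x∈ y∈ ¬straddle with i ≤? x | i ≤? y
  ... | yes i≤x | yes i≤y rewrite f-≥ i≤x | f-≥ i≤y = (λ x<y → x<y) , (λ y<x → y<x)
  ... | yes i≤x | no  i≰y = (λ x<y → ⊥-elim (<-asym x<y (<-≤-trans (≰⇒> i≰y) i≤x))) ,
                            (λ _ → subst (f y <_) (sym (f-≥ i≤x)) (<-≤-trans (f<i y∈ (≰⇒> i≰y)) i≤x))
  ... | no  i≰x | yes i≤y = (λ _ → subst (f x <_) (sym (f-≥ i≤y)) (<-≤-trans (f<i x∈ (≰⇒> i≰x)) i≤y)) ,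
                            (λ y<x → ⊥-elim (<-asym y<x (<-≤-trans (≰⇒> i≰x) i≤y)))
  ... | no  i≰x | no  i≰y with ∈L⊎∈R x∈ (≰⇒> i≰x) | ∈L⊎∈R y∈ (≰⇒> i≰y)
  ... | inj₁ x∈L | inj₁ y∈L = f-mono-L x∈L y∈L , f-mono-L y∈L x∈L
  ... | inj₂ x∈R | inj₂ y∈R = f-mono-R x∈R y∈R , f-mono-R y∈R x∈R
  ... | inj₁ x∈L | inj₂ y∈R = ⊥-elim (¬straddle (inj₁ (x∈L , y∈R)))
  ... | inj₂ x∈R | inj₁ y∈L = ⊥-elim (¬straddle (inj₂ (x∈R , y∈L)))

  f-injective : ∀ {x y} → x ∈ σ → y ∈ σ → f x ≡ f y → x ≡ y
  f-injective x∈ y∈ fx≡fy = preservesOrder⇒injective (f-preserves-order x∈ y∈ ¬straddle) fx≡fy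
    where
    ¬straddle : ¬ Straddle _ _
    ¬straddle (inj₁ (x∈L , y∈R)) = <-irrefl (sym fx≡fy) (f-R<f-L x∈L y∈R)
    ¬straddle (inj₂ (x∈R , y∈L)) = <-irrefl fx≡fy (f-R<f-L y∈L x∈R)

  L-left-of-R : ∀ {x y} → x ∈ L → y ∈ R → pos x σ < pos y σ
  L-left-of-R x∈L y∈R with ∈R⇒right-of-i y∈R
  ... | i∈ , i<y = <-trans (∈L⇒left-of-i x∈L i∈) i<y

  f-reflects-order : ∀ {x y} → x ∈ σ → y ∈ σ → pos x σ < pos y σ → f x < f y → x < y
  f-reflects-order x∈ y∈ x<ₚy fx<fy = preservesOrder⇒reflects< (f-preserves-order x∈ y∈ ¬straddle) fx<fy
    where
    ¬straddle : ¬ Straddle _ _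
    ¬straddle (inj₁ (x∈L , y∈R)) = <-asym fx<fy (f-R<f-L x∈L y∈R)
    ¬straddle (inj₂ (x∈R , y∈L)) = <-asym x<ₚy (L-left-of-R y∈L x∈R)

  f-preserves-adjacent-order : Linked (PreservesOrder f) σ
  f-preserves-adjacent-order =
    linked-by-pos (PreservesOrder f) d (λ x∈ y∈ adj → f-preserves-order x∈ y∈ (¬straddle adj))
    where
    ¬straddle : ∀ {x y} → pos y σ ≡ suc (pos x σ) → ¬ Straddle x y
    ¬straddle adj (inj₁ (x∈L , y∈R)) with ∈R⇒right-of-i y∈R
    ... | i∈ , i<y = <-irrefl refl (<-≤-trans (∈L⇒left-of-i x∈L i∈) (≤-pred (subst (_ <_) adj i<y)))
    ¬straddle adj (inj₂ (x∈R , y∈L)) = <-asym (subst (_ <_) (sym adj) (n<1+n _)) (L-left-of-R y∈L x∈R)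

  perm-map-f : ∀ {n τ} → Perm n τ → (∀ {x} → x ∈ τ → x ∈ σ) → i ≤ n → Perm n (map f τ)
  perm-map-f {n} pm τ⊆σ i≤n = perm-map f pm (λ x∈ y∈ → f-injective (τ⊆σ x∈) (τ⊆σ y∈)) f-bounded
    where
    f-bounded : ∀ {x} → x ∈ _ → 1 ≤ f x × f x ≤ n
    f-bounded {x} x∈ with i ≤? x
    ... | yes i≤x = f≥1 (τ⊆σ x∈) , subst (_≤ n) (sym (f-≥ i≤x)) (proj₂ (bounded pm x∈))
    ... | no  i≰x = f≥1 (τ⊆σ x∈) , <⇒≤ (<-≤-trans (f<i (τ⊆σ x∈) (≰⇒> i≰x)) i≤n)

swdᵢ≡map-slide : ∀ i σ → swdᵢ i σ ≡ map (slide i (reverse σ)) σ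
swdᵢ≡map-slide i σ = begin
  reverse (map f (reverse σ)) ≡⟨ reverse-map f (reverse σ) ⟨
  map f (reverse (reverse σ)) ≡⟨ cong (map f) (reverse-involutive σ) ⟩
  map f σ                     ∎
  where
  open ≡-Reasoning
  f = slide i (reverse σ)

module _ {n σ i} (pm : Perm n σ) (1≤i : 1 ≤ i) (i≤n : i ≤ n) where

  private
    module Up   = Slide i σ (distinct pm) (proj₁ ∘ bounded pm) 1≤i
    module Down = Slide i (reverse σ) (distinct (perm-reverse pm)) (proj₁ ∘ bounded (perm-reverse pm)) 1≤i

  perm-swuᵢ : Perm n (swuᵢ i σ)
  perm-swuᵢ rewrite swuᵢ≡map-slide i σ = Up.perm-map-f pm id i≤n

  Des-swuᵢ : Des (swuᵢ i σ) ≡ Des σ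
  Des-swuᵢ rewrite swuᵢ≡map-slide i σ = desFrom-map Up.f 1 (distinct pm) Up.f-preserves-adjacent-order

  perm-swdᵢ : Perm n (swdᵢ i σ)
  perm-swdᵢ rewrite swdᵢ≡map-slide i σ = Down.perm-map-f pm Any.reverse⁺ i≤n

  Des-swdᵢ : Des (swdᵢ i σ) ≡ Des σ
  Des-swdᵢ rewrite swdᵢ≡map-slide i σ =
    desFrom-map Down.f 1 (distinct pm)
      (subst (Linked (PreservesOrder Down.f)) (reverse-involutive σ)
             (linked-reverse swap Down.f-preserves-adjacent-order))
    where
    swap : ∀ {g x y} → PreservesOrder g x y → PreservesOrder g y x
    swap (x<y⇒ , y<x⇒) = y<x⇒ , x<y⇒

foldr-invariant : ∀ (P : List ℕ → Set) (op : ℕ → List ℕ → List ℕ) {π} is →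
                  (∀ {i σ} → i ∈ is → P σ → P (op i σ)) → P π → P (foldr op π is)
foldr-invariant P op []       _    Pπ = Pπ
foldr-invariant P op (i ∷ is) step Pπ = step (here refl) (foldr-invariant P op is (step ∘ there) Pπ)

compose≡foldr-range : ∀ op {n} π → length π ≡ n → compose op π ≡ foldr op π (range 1 n)
compose≡foldr-range op π len = cong (foldr op π) (trans (cong [1‥_] len) ([1‥n]≡range _))

perm-Des-compose : ∀ {n π} op → (∀ {i σ} → 1 ≤ i → i ≤ n → Perm n σ → Perm n (op i σ) × Des (op i σ) ≡ Des σ) →
                   Perm n π → Perm n (compose op π) × Des (compose op π) ≡ Des π
perm-Des-compose {n} {π} op step pm rewrite compose≡foldr-range op π (length≡ pm) =
  foldr-invariant (λ σ → Perm n σ × Des σ ≡ Des π) op (range 1 n) step′ (pm , refl)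
  where
  step′ : ∀ {i σ} → i ∈ range 1 n → Perm n σ × Des σ ≡ Des π → Perm n (op i σ) × Des (op i σ) ≡ Des π
  step′ i∈ (pmσ , Desσ) with uncurry step (∈-range1⁻ n i∈) pmσ
  ... | pm-op , Des-op = pm-op , trans Des-op Desσ

perm-Des-swu : ∀ {n π} → Perm n π → Perm n (swu π) × Des (swu π) ≡ Des π
perm-Des-swu = perm-Des-compose swuᵢ (λ 1≤i i≤n pm → perm-swuᵢ pm 1≤i i≤n , Des-swuᵢ pm 1≤i i≤n)

perm-Des-swd : ∀ {n π} → Perm n π → Perm n (swd π) × Des (swd π) ≡ Des π
perm-Des-swd = perm-Des-compose swdᵢ (λ 1≤i i≤n pm → perm-swdᵢ pm 1≤i i≤n , Des-swdᵢ pm 1≤i i≤n)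

-- swu π avoids 132

Avoids132Above : ℕ → List ℕ → Set
Avoids132Above t ρ = ∀ {x y z} → x ∷ y ∷ z ∷ [] ⊆ ρ → t ≤ y → x < z → z < y → ⊥

module _ {n σ j} (pm : Perm n σ) (1≤j : 1 ≤ j) where
  open Slide j σ (distinct pm) (proj₁ ∘ bounded pm) 1≤j

  avoids132Above-slide : Avoids132Above (suc j) σ → ∀ {x y z} → x ∷ y ∷ z ∷ [] ⊆ σ →
                         j ≤ f y → f x < f z → f z < f y → ⊥
  avoids132Above-slide avoids {x} {y} {z} xyz⊆ j≤fy fx<fz fz<fy = by-cases (m≤n⇒m<n∨m≡n j≤y)
    where
    x∈ = Sublist.lookup xyz⊆ (here refl)
    y∈ = Sublist.lookup xyz⊆ (there (here refl))
    z∈ = Sublist.lookup xyz⊆ (there (there (here refl)))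
    x<ₚy = proj₁ (⊆₃⇒pos< (distinct pm) xyz⊆)
    y<ₚz = proj₂ (⊆₃⇒pos< (distinct pm) xyz⊆)
    j≤y : j ≤ y
    j≤y with j ≤? y
    ... | yes j≤y = j≤y
    ... | no  j≰y = ⊥-elim (<⇒≱ (f<i y∈ (≰⇒> j≰y)) j≤fy)
    fz<y : f z < y
    fz<y = subst (f z <_) (f-≥ j≤y) fz<fy
    by-cases : j < y ⊎ j ≡ y → ⊥
    by-cases (inj₁ j<y) = avoids xyz⊆ j<y (f-reflects-order x∈ z∈ (<-trans x<ₚy y<ₚz) fx<fz)
                                       (f-reflects-<-above-i z∈ j≤y fz<y)
    by-cases (inj₂ j≡y) = <-asym fx<fz (f-R<f-L x∈L z∈R)
      where
      j∈ = subst (_∈ σ) (sym j≡y) y∈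
      fz<j = subst (f z <_) (sym j≡y) fz<y
      x∈L = ∈L⁺ x∈ (f-reflects-<-above-i x∈ ≤-refl (<-trans fx<fz fz<j)) j∈
                (subst (λ v → pos x σ < pos v σ) (sym j≡y) x<ₚy)
      z∈R = ∈R⁺ z∈ (f-reflects-<-above-i z∈ ≤-refl fz<j) j∈
                (subst (λ v → pos v σ < pos z σ) (sym j≡y) y<ₚz)

  avoids132Above-swuᵢ : Avoids132Above (suc j) σ → Avoids132Above j (swuᵢ j σ)
  avoids132Above-swuᵢ avoids sub with ⊆-map⁻ f σ sub
  ... | x ∷ y ∷ z ∷ [] , xyz⊆ , refl = avoids132Above-slide avoids xyz⊆

perm-foldr-swuᵢ : ∀ {n π} is → (∀ {i} → i ∈ is → 1 ≤ i × i ≤ n) → Perm n π → Perm n (foldr swuᵢ π is)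
perm-foldr-swuᵢ {n} is bounds =
  foldr-invariant (Perm n) swuᵢ is (λ i∈ pmσ → uncurry (perm-swuᵢ pmσ) (bounds i∈))

avoids132Above-foldr : ∀ {n π} → Perm n π → ∀ a k → a + k ≡ suc n → 1 ≤ a →
                       Avoids132Above a (foldr swuᵢ π (range a k))
avoids132Above-foldr {n} pm a zero a+0≡ _ sub a≤y _ _ =
  <⇒≱ (s≤s (proj₂ (bounded pm (Sublist.lookup sub (there (here refl))))))
      (subst (_≤ _) (trans (sym (+-identityʳ a)) a+0≡) a≤y)
avoids132Above-foldr {n} {π} pm a (suc k) a+k≡ 1≤a =
  avoids132Above-swuᵢ (perm-foldr-swuᵢ (range (suc a) k) bounds pm) 1≤a
    (avoids132Above-foldr pm (suc a) k (trans (sym (+-suc a k)) a+k≡) (s≤s z≤n))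
  where
  bounds : ∀ {i} → i ∈ range (suc a) k → 1 ≤ i × i ≤ n
  bounds {i} i∈ with ∈-range⁻ (suc a) k i∈
  ... | a<i , i<1+a+k = ≤-trans (s≤s z≤n) a<i , ≤-pred (subst (i <_) (trans (sym (+-suc a k)) a+k≡) i<1+a+k)

swu-avoids132 : ∀ {n π} → Perm n π → Avoids132 (swu π)
swu-avoids132 {n} {π} pm {y = y} sub with perm-Des-swu pm
... | pm-swu , _ rewrite compose≡foldr-range swuᵢ π (length≡ pm) =
  avoids132Above-foldr pm 1 n refl ≤-refl sub (proj₁ (bounded pm-swu (Sublist.lookup sub (there (here refl)))))

-- des π⁻¹ = des π for π avoiding 312, 231 or 132

module Neighbours {n ρ} (pm : Perm n ρ) where

  pos<-if-≢ : ∀ {x c} → x ∈ ρ → c ∈ ρ → pos x ρ ≤ pos c ρ → x ≢ c → pos x ρ < pos c ρ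
  pos<-if-≢ x∈ c∈ x≤c x≢c = ≤∧≢⇒< x≤c (x≢c ∘ pos-injective x∈ c∈)

  left-neighbour : ∀ {b} → b ∈ ρ → 1 < pos b ρ →
                   nth (pos b ρ ∸ 1) ρ ∈ ρ × suc (pos (nth (pos b ρ ∸ 1) ρ) ρ) ≡ pos b ρ
  left-neighbour {b} b∈ 1<p = nth∈perm pm 1≤k k≤n , trans (cong suc (pos-nth-perm pm 1≤k k≤n)) suc-k≡p
    where
    suc-k≡p : suc (pos b ρ ∸ 1) ≡ pos b ρ
    suc-k≡p = m+[n∸m]≡n (<⇒≤ 1<p)
    1≤k = ≤-pred (subst (2 ≤_) (sym suc-k≡p) 1<p)
    k≤n = ≤-trans (m∸n≤m (pos b ρ) 1) (pos≤n-perm pm b∈)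

  right-neighbour : ∀ {b} → b ∈ ρ → pos b ρ < n →
                    nth (suc (pos b ρ)) ρ ∈ ρ × pos (nth (suc (pos b ρ)) ρ) ρ ≡ suc (pos b ρ)
  right-neighbour b∈ p<n = nth∈perm pm (s≤s z≤n) p<n , pos-nth-perm pm (s≤s z≤n) p<n

  module _ (avoids : Avoids312 ρ) {b} (b∈ : b ∈ ρ) where

    descent-bottom⇒inverse-descent : 1 < pos b ρ → b < nth (pos b ρ ∸ 1) ρ → b < n × pos (suc b) ρ < pos b ρ
    descent-bottom⇒inverse-descent 1<p b<c = b<n , by-cases (suc b ≟ c)
      where
      c = nth (pos b ρ ∸ 1) ρ
      c∈ = proj₁ (left-neighbour b∈ 1<p)
      c<ₚb : pos c ρ < pos b ρ
      c<ₚb = ≤-reflexive (proj₂ (left-neighbour b∈ 1<p))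
      b<n = <-≤-trans b<c (proj₂ (bounded pm c∈))
      b+1∈ = ∈-perm pm (s≤s z≤n) b<n
      by-cases : Dec (suc b ≡ c) → pos (suc b) ρ < pos b ρ
      by-cases (yes b+1≡c) = subst (λ v → pos v ρ < pos b ρ) (sym b+1≡c) c<ₚb
      by-cases (no  b+1≢c) with <-cmp (pos (suc b) ρ) (pos b ρ)
      ... | tri< b+1<ₚb _ _ = b+1<ₚb
      ... | tri≈ _ b+1≡ₚb _ = ⊥-elim (<-irrefl (sym (pos-injective b+1∈ b∈ b+1≡ₚb)) (n<1+n b))
      ... | tri> _ _ b<ₚb+1 =
        ⊥-elim (avoids (pos-increasing⇒⊆ c∈ b∈ b+1∈ c<ₚb b<ₚb+1) (n<1+n b) (≤∧≢⇒< b<c b+1≢c))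

    inverse-descent⇒descent-bottom : b < n → pos (suc b) ρ < pos b ρ → 1 < pos b ρ × b < nth (pos b ρ ∸ 1) ρ
    inverse-descent⇒descent-bottom b<n b+1<ₚb = 1<p , b<c
      where
      b+1∈ = ∈-perm pm (s≤s z≤n) b<n
      1<p = ≤-<-trans (pos≥1 b+1∈) b+1<ₚb
      c = nth (pos b ρ ∸ 1) ρ
      c∈ = proj₁ (left-neighbour b∈ 1<p)
      c-adj = proj₂ (left-neighbour b∈ 1<p)
      b<c : b < c
      b<c with <-cmp b c
      ... | tri< b<c _ _ = b<c
      ... | tri≈ _ b≡c _ =
        ⊥-elim (<-irrefl (sym (subst (λ v → suc (pos v ρ) ≡ pos b ρ) (sym b≡c) c-adj)) (n<1+n _))
      ... | tri> _ _ c<b =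
        ⊥-elim (avoids (pos-increasing⇒⊆ b+1∈ c∈ b∈ b+1<ₚc (≤-reflexive c-adj)) c<b (n<1+n b))
        where
        b+1<ₚc = pos<-if-≢ b+1∈ c∈ (≤-pred (subst (pos (suc b) ρ <_) (sym c-adj) b+1<ₚb))
                           (λ b+1≡c → <-asym c<b (subst (b <_) b+1≡c (n<1+n b)))

  module _ (avoids : Avoids231 ρ) {a} (a+1∈ : suc a ∈ ρ) where

    private
      a∈ : 1 ≤ a → a ∈ ρ
      a∈ 1≤a = ∈-perm pm 1≤a (≤-trans (n≤1+n a) (proj₂ (bounded pm a+1∈)))

    descent-top⇒inverse-descent : pos (suc a) ρ < n → nth (suc (pos (suc a) ρ)) ρ < suc a →
                                  1 ≤ a × pos (suc a) ρ < pos a ρ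
    descent-top⇒inverse-descent p<n c<a+1 = 1≤a , by-cases (a ≟ c)
      where
      c = nth (suc (pos (suc a) ρ)) ρ
      c∈ = proj₁ (right-neighbour a+1∈ p<n)
      a+1<ₚc : pos (suc a) ρ < pos c ρ
      a+1<ₚc = ≤-reflexive (sym (proj₂ (right-neighbour a+1∈ p<n)))
      1≤a = ≤-trans (proj₁ (bounded pm c∈)) (≤-pred c<a+1)
      by-cases : Dec (a ≡ c) → pos (suc a) ρ < pos a ρ
      by-cases (yes a≡c) = subst (λ v → pos (suc a) ρ < pos v ρ) (sym a≡c) a+1<ₚc
      by-cases (no  a≢c) with <-cmp (pos a ρ) (pos (suc a) ρ)
      ... | tri> _ _ a+1<ₚa = a+1<ₚa
      ... | tri≈ _ a≡ₚa+1 _ = ⊥-elim (<-irrefl (pos-injective (a∈ 1≤a) a+1∈ a≡ₚa+1) (n<1+n a))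
      ... | tri< a<ₚa+1 _ _ = ⊥-elim (avoids (pos-increasing⇒⊆ (a∈ 1≤a) a+1∈ c∈ a<ₚa+1 a+1<ₚc)
                                             (≤∧≢⇒< (≤-pred c<a+1) (a≢c ∘ sym)) (n<1+n a))

    inverse-descent⇒descent-top : 1 ≤ a → pos (suc a) ρ < pos a ρ →
                                  pos (suc a) ρ < n × nth (suc (pos (suc a) ρ)) ρ < suc a
    inverse-descent⇒descent-top 1≤a a+1<ₚa = p<n , c<a+1
      where
      p<n = <-≤-trans a+1<ₚa (pos≤n-perm pm (a∈ 1≤a))
      c = nth (suc (pos (suc a) ρ)) ρ
      c∈ = proj₁ (right-neighbour a+1∈ p<n)
      c-adj = proj₂ (right-neighbour a+1∈ p<n)
      c<a+1 : c < suc a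
      c<a+1 with <-cmp c (suc a)
      ... | tri< c<a+1 _ _ = c<a+1
      ... | tri≈ _ c≡a+1 _ =
        ⊥-elim (<-irrefl (subst (λ v → pos v ρ ≡ suc (pos (suc a) ρ)) c≡a+1 c-adj) (n<1+n _))
      ... | tri> _ _ a+1<c =
        ⊥-elim (avoids (pos-increasing⇒⊆ a+1∈ c∈ (a∈ 1≤a) (≤-reflexive (sym c-adj)) c<ₚa) (n<1+n a) a+1<c)
        where
        c<ₚa = pos<-if-≢ c∈ (a∈ 1≤a) (subst (_≤ pos a ρ) (sym c-adj) a+1<ₚa)
                         (λ c≡a → <-asym a+1<c (subst (_< suc a) (sym c≡a) (n<1+n a)))

  module _ (avoids : Avoids132 ρ) {a} (a+1∈ : suc a ∈ ρ) where

    private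
      a∈ : 1 ≤ a → a ∈ ρ
      a∈ 1≤a = ∈-perm pm 1≤a (≤-trans (n≤1+n a) (proj₂ (bounded pm a+1∈)))

    ascent-top⇒inverse-ascent : 1 < pos (suc a) ρ → nth (pos (suc a) ρ ∸ 1) ρ < suc a →
                                1 ≤ a × pos a ρ < pos (suc a) ρ
    ascent-top⇒inverse-ascent 1<p c<a+1 = 1≤a , by-cases (a ≟ c)
      where
      c = nth (pos (suc a) ρ ∸ 1) ρ
      c∈ = proj₁ (left-neighbour a+1∈ 1<p)
      c<ₚa+1 : pos c ρ < pos (suc a) ρ
      c<ₚa+1 = ≤-reflexive (proj₂ (left-neighbour a+1∈ 1<p))
      1≤a = ≤-trans (proj₁ (bounded pm c∈)) (≤-pred c<a+1)
      by-cases : Dec (a ≡ c) → pos a ρ < pos (suc a) ρ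
      by-cases (yes a≡c) = subst (λ v → pos v ρ < pos (suc a) ρ) (sym a≡c) c<ₚa+1
      by-cases (no  a≢c) with <-cmp (pos a ρ) (pos (suc a) ρ)
      ... | tri< a<ₚa+1 _ _ = a<ₚa+1
      ... | tri≈ _ a≡ₚa+1 _ = ⊥-elim (<-irrefl (pos-injective (a∈ 1≤a) a+1∈ a≡ₚa+1) (n<1+n a))
      ... | tri> _ _ a+1<ₚa = ⊥-elim (avoids (pos-increasing⇒⊆ c∈ a+1∈ (a∈ 1≤a) c<ₚa+1 a+1<ₚa)
                                             (≤∧≢⇒< (≤-pred c<a+1) (a≢c ∘ sym)) (n<1+n a))

    inverse-ascent⇒ascent-top : 1 ≤ a → pos a ρ < pos (suc a) ρ →
                                1 < pos (suc a) ρ × nth (pos (suc a) ρ ∸ 1) ρ < suc a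
    inverse-ascent⇒ascent-top 1≤a a<ₚa+1 = 1<p , c<a+1
      where
      1<p = ≤-<-trans (pos≥1 (a∈ 1≤a)) a<ₚa+1
      c = nth (pos (suc a) ρ ∸ 1) ρ
      c∈ = proj₁ (left-neighbour a+1∈ 1<p)
      c-adj = proj₂ (left-neighbour a+1∈ 1<p)
      c<a+1 : c < suc a
      c<a+1 with <-cmp c (suc a)
      ... | tri< c<a+1 _ _ = c<a+1
      ... | tri≈ _ c≡a+1 _ =
        ⊥-elim (<-irrefl (sym (subst (λ v → suc (pos v ρ) ≡ pos (suc a) ρ) c≡a+1 c-adj)) (n<1+n _))
      ... | tri> _ _ a+1<c =
        ⊥-elim (avoids (pos-increasing⇒⊆ (a∈ 1≤a) c∈ a+1∈ a<ₚc (≤-reflexive c-adj)) (n<1+n a) a+1<c)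
        where
        a<ₚc = pos<-if-≢ (a∈ 1≤a) c∈ (≤-pred (subst (pos a ρ <_) (sym c-adj) a<ₚa+1))
                         (λ a≡c → <-asym a+1<c (subst (_< suc a) a≡c (n<1+n a)))

<ᵇ∧<ᵇ-cong : ∀ {a b c d e f g h} → (a < b → c < d → e < f × g < h) → (e < f → g < h → a < b × c < d) →
             ((a <ᵇ b) ∧ (c <ᵇ d)) ≡ ((e <ᵇ f) ∧ (g <ᵇ h))
<ᵇ∧<ᵇ-cong {a} {b} {c} {d} {e} {f} {g} {h} fwd bwd =
  reflects-≡ (<ᵇ-reflects-< a b ×-reflects <ᵇ-reflects-< c d) (<ᵇ-reflects-< e f ×-reflects <ᵇ-reflects-< g h)
  where
  reflects-≡ : ∀ {p q} → Reflects (a < b × c < d) p → Reflects (e < f × g < h) q → p ≡ q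
  reflects-≡ (ofʸ _)  (ofʸ _)  = refl
  reflects-≡ (ofⁿ _)  (ofⁿ _)  = refl
  reflects-≡ (ofʸ (a<b , c<d)) (ofⁿ ¬Q) = ⊥-elim (¬Q (fwd a<b c<d))
  reflects-≡ (ofⁿ ¬P) (ofʸ (e<f , g<h)) = ⊥-elim (¬P (bwd e<f g<h))

des-inv≡des-empty : ∀ {ρ} → Perm 0 ρ → des (inv ρ) ≡ des ρ
des-inv≡des-empty {[]}    _  = refl
des-inv≡des-empty {_ ∷ _} pm with () ← length≡ pm

des-inv≡des-312 : ∀ {n ρ} → Perm n ρ → Avoids312 ρ → des (inv ρ) ≡ des ρ
des-inv≡des-312 {zero}      pm _      = des-inv≡des-empty pm
des-inv≡des-312 {suc m} {ρ} pm avoids = begin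
  des (inv ρ)                                         ≡⟨ des-inv≡count ρ (length≡ pm) ⟩
  count (λ k → pos (suc k) ρ <ᵇ pos k ρ) (range 1 m)  ≡⟨ count-range-shiftˡ (λ k k′ → pos k′ ρ <ᵇ pos k ρ) m ⟩
  count inverse-descent-at (range 1 (suc m))          ≡⟨ count-cong (range 1 (suc m)) pointwise ⟩
  count descent-bottom (range 1 (suc m))              ≡⟨ count-adjacent-by-right-entry pm (λ k k′ → nth k′ ρ <ᵇ nth k ρ) ⟨
  count (λ k → nth (suc k) ρ <ᵇ nth k ρ) (range 1 m)  ≡⟨ des≡count ρ (length≡ pm) ⟨
  des ρ                                               ∎
  where
  open ≡-Reasoning
  open Neighbours pm
  inverse-descent-at descent-bottom : ℕ → Bool
  inverse-descent-at b = (b <ᵇ suc m) ∧ (pos (suc b) ρ <ᵇ pos b ρ)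
  descent-bottom b = (1 <ᵇ pos b ρ) ∧ (nth (pos b ρ) ρ <ᵇ nth (pos b ρ ∸ 1) ρ)
  pointwise : ∀ {b} → b ∈ range 1 (suc m) → inverse-descent-at b ≡ descent-bottom b
  pointwise b∈ with range⊆perm pm b∈
  ... | b∈ρ rewrite nth-pos b∈ρ =
    <ᵇ∧<ᵇ-cong (inverse-descent⇒descent-bottom avoids b∈ρ) (descent-bottom⇒inverse-descent avoids b∈ρ)

des-inv≡des-231 : ∀ {n ρ} → Perm n ρ → Avoids231 ρ → des (inv ρ) ≡ des ρ
des-inv≡des-231 {zero}      pm _      = des-inv≡des-empty pm
des-inv≡des-231 {suc m} {ρ} pm avoids = begin
  des (inv ρ)                                         ≡⟨ des-inv≡count ρ (length≡ pm) ⟩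
  count (λ k → pos (suc k) ρ <ᵇ pos k ρ) (range 1 m)  ≡⟨ count-range-shiftʳ (λ k k′ → pos k′ ρ <ᵇ pos k ρ) m ⟩
  count inverse-descent-below (range 1 (suc m))       ≡⟨ count-cong (range 1 (suc m)) pointwise ⟩
  count descent-top (range 1 (suc m))                 ≡⟨ count-adjacent-by-left-entry pm (λ k k′ → nth k′ ρ <ᵇ nth k ρ) ⟨
  count (λ k → nth (suc k) ρ <ᵇ nth k ρ) (range 1 m)  ≡⟨ des≡count ρ (length≡ pm) ⟨
  des ρ                                               ∎
  where
  open ≡-Reasoning
  open Neighbours pm
  inverse-descent-below descent-top : ℕ → Bool
  inverse-descent-below b = (1 <ᵇ b) ∧ (pos b ρ <ᵇ pos (b ∸ 1) ρ)
  descent-top b = (pos b ρ <ᵇ suc m) ∧ (nth (suc (pos b ρ)) ρ <ᵇ nth (pos b ρ) ρ)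
  pointwise : ∀ {b} → b ∈ range 1 (suc m) → inverse-descent-below b ≡ descent-top b
  pointwise {zero}  b∈ with () ← proj₁ (∈-range1⁻ (suc m) b∈)
  pointwise {suc a} b∈ with range⊆perm pm b∈
  ... | b∈ρ rewrite nth-pos b∈ρ =
    <ᵇ∧<ᵇ-cong (inverse-descent⇒descent-top avoids b∈ρ) (descent-top⇒inverse-descent avoids b∈ρ)

des-inv≡des-132 : ∀ {n ρ} → Perm n ρ → Avoids132 ρ → des (inv ρ) ≡ des ρ
des-inv≡des-132 {zero}      pm _      = des-inv≡des-empty pm
des-inv≡des-132 {suc m} {ρ} pm avoids = +-cancelʳ-≡ inverse-ascents (des (inv ρ)) (des ρ) (begin
  des (inv ρ) + inverse-ascents      ≡⟨ cong (_+ inverse-ascents) (des-inv≡count ρ (length≡ pm)) ⟩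
  inverse-descents + inverse-ascents ≡⟨ descents+ascents (λ k → pos k ρ) m pos-adjacent-≢ ⟩
  m                                  ≡⟨ descents+ascents (λ k → nth k ρ) m nth-adjacent-≢ ⟨
  descents + ascents                 ≡⟨ cong₂ _+_ (sym (des≡count ρ (length≡ pm))) ascents≡inverse-ascents ⟩
  des ρ + inverse-ascents            ∎)
  where
  open ≡-Reasoning
  open Neighbours pm
  descents ascents inverse-descents inverse-ascents : ℕ
  descents         = count (λ k → nth (suc k) ρ <ᵇ nth k ρ) (range 1 m)
  ascents          = count (λ k → nth k ρ <ᵇ nth (suc k) ρ) (range 1 m)
  inverse-descents = count (λ k → pos (suc k) ρ <ᵇ pos k ρ) (range 1 m)
  inverse-ascents  = count (λ k → pos k ρ <ᵇ pos (suc k) ρ) (range 1 m)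

  adjacent∈ρ : ∀ {k} → k ∈ range 1 m → (1 ≤ k × k ≤ suc m) × (1 ≤ suc k × suc k ≤ suc m)
  adjacent∈ρ k∈ with ∈-range1⁻ m k∈
  ... | 1≤k , k≤m = (1≤k , m≤n⇒m≤1+n k≤m) , (s≤s z≤n , s≤s k≤m)

  pos-adjacent-≢ : ∀ {k} → k ∈ range 1 m → pos k ρ ≢ pos (suc k) ρ
  pos-adjacent-≢ k∈ eq with adjacent∈ρ k∈
  ... | k-bounds , k+1-bounds =
    <-irrefl (pos-injective (uncurry (∈-perm pm) k-bounds) (uncurry (∈-perm pm) k+1-bounds) eq) (n<1+n _)

  nth-adjacent-≢ : ∀ {k} → k ∈ range 1 m → nth k ρ ≢ nth (suc k) ρ
  nth-adjacent-≢ {k} k∈ eq with adjacent∈ρ k∈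
  ... | k-bounds , k+1-bounds = <-irrefl (begin
    k                       ≡⟨ uncurry (pos-nth-perm pm) k-bounds ⟨
    pos (nth k ρ) ρ         ≡⟨ cong (λ v → pos v ρ) eq ⟩
    pos (nth (suc k) ρ) ρ   ≡⟨ uncurry (pos-nth-perm pm) k+1-bounds ⟩
    suc k                   ∎) (n<1+n k)

  ascent-top inverse-ascent-below : ℕ → Bool
  ascent-top b = (1 <ᵇ pos b ρ) ∧ (nth (pos b ρ ∸ 1) ρ <ᵇ nth (pos b ρ) ρ)
  inverse-ascent-below b = (1 <ᵇ b) ∧ (pos (b ∸ 1) ρ <ᵇ pos b ρ)

  pointwise : ∀ {b} → b ∈ range 1 (suc m) → ascent-top b ≡ inverse-ascent-below b
  pointwise {zero}  b∈ with () ← proj₁ (∈-range1⁻ (suc m) b∈)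
  pointwise {suc a} b∈ with range⊆perm pm b∈
  ... | b∈ρ rewrite nth-pos b∈ρ =
    <ᵇ∧<ᵇ-cong (ascent-top⇒inverse-ascent avoids b∈ρ) (inverse-ascent⇒ascent-top avoids b∈ρ)

  ascents≡inverse-ascents : ascents ≡ inverse-ascents
  ascents≡inverse-ascents = begin
    ascents                                ≡⟨ count-adjacent-by-right-entry pm (λ k k′ → nth k ρ <ᵇ nth k′ ρ) ⟩
    count ascent-top (range 1 (suc m))     ≡⟨ count-cong (range 1 (suc m)) pointwise ⟩
    count inverse-ascent-below (range 1 (suc m)) ≡⟨ count-range-shiftʳ (λ k k′ → pos k ρ <ᵇ pos k′ ρ) m ⟨
    inverse-ascents                        ∎

-- swr and swl as conjugates of swu and swd

foldr-swdᵢ : ∀ σ is → foldr swdᵢ σ is ≡ reverse (foldr swuᵢ (reverse σ) is)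
foldr-swdᵢ σ []       = sym (reverse-involutive σ)
foldr-swdᵢ σ (i ∷ is) rewrite foldr-swdᵢ σ is | reverse-involutive (foldr swuᵢ (reverse σ) is) = refl

swd≡reverse∘swu∘reverse : ∀ σ → swd σ ≡ reverse (swu (reverse σ))
swd≡reverse∘swu∘reverse σ = trans (foldr-swdᵢ σ [1‥ length σ ])
  (cong (λ l → reverse (foldr swuᵢ (reverse σ) [1‥ l ])) (sym (length-reverse σ)))

swd-avoids231 : ∀ {n σ} → Perm n σ → Avoids231 (swd σ)
swd-avoids231 {σ = σ} pm rewrite swd≡reverse∘swu∘reverse σ =
  Avoids132⇒reverse-Avoids231 (swu-avoids132 (perm-reverse pm))

swrᵢ≡inv∘swuᵢ∘inv : ∀ i σ → swrᵢ i σ ≡ inv (swuᵢ i (inv σ))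
swrᵢ≡inv∘swuᵢ∘inv i σ = cong inv (trans (reverse-involutive _) (cong (swuᵢ i) (reverse-involutive (inv σ))))

swlᵢ≡inv∘swdᵢ∘inv : ∀ i σ → swlᵢ i σ ≡ inv (swdᵢ i (inv σ))
swlᵢ≡inv∘swdᵢ∘inv i σ = refl

foldr-conjugate : ∀ {n π} (op op′ : ℕ → List ℕ → List ℕ) → (∀ i σ → op′ i σ ≡ inv (op i (inv σ))) →
                  ∀ is → (∀ {i σ} → i ∈ is → Perm n σ → Perm n (op i σ)) → Perm n π →
                  foldr op′ π is ≡ inv (foldr op (inv π) is)
foldr-conjugate op op′ conj []       _       pm = sym (inv-involutive pm)
foldr-conjugate {n} {π} op op′ conj (i ∷ is) op-perm pm = begin
  op′ i (foldr op′ π is)    ≡⟨ cong (op′ i) (foldr-conjugate op op′ conj is (op-perm ∘ there) pm) ⟩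
  op′ i (inv σ)             ≡⟨ conj i (inv σ) ⟩
  inv (op i (inv (inv σ)))  ≡⟨ cong (inv ∘ op i) (inv-involutive perm-σ) ⟩
  inv (op i σ)              ∎
  where
  open ≡-Reasoning
  σ = foldr op (inv π) is
  perm-σ = foldr-invariant (Perm n) op is (op-perm ∘ there) (perm-inv pm)

swr≡inv∘swu∘inv : ∀ {n π} → Perm n π → swr π ≡ inv (swu (inv π))
swr≡inv∘swu∘inv {n} {π} pm rewrite compose≡foldr-range swrᵢ π (length≡ pm)
                                 | compose≡foldr-range swuᵢ (inv π) (length≡ (perm-inv pm)) =
  foldr-conjugate swuᵢ swrᵢ swrᵢ≡inv∘swuᵢ∘inv (range 1 n) step pm
  where
  step : ∀ {i σ} → i ∈ range 1 n → Perm n σ → Perm n (swuᵢ i σ)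
  step i∈ pmσ = uncurry (perm-swuᵢ pmσ) (∈-range1⁻ n i∈)

swl≡inv∘swd∘inv : ∀ {n π} → Perm n π → swl π ≡ inv (swd (inv π))
swl≡inv∘swd∘inv {n} {π} pm rewrite compose≡foldr-range swlᵢ π (length≡ pm)
                                 | compose≡foldr-range swdᵢ (inv π) (length≡ (perm-inv pm)) =
  foldr-conjugate swdᵢ swlᵢ swlᵢ≡inv∘swdᵢ∘inv (range 1 n) step pm
  where
  step : ∀ {i σ} → i ∈ range 1 n → Perm n σ → Perm n (swdᵢ i σ)
  step i∈ pmσ = uncurry (perm-swdᵢ pmσ) (∈-range1⁻ n i∈)

lemma4p4 : (n : ℕ) (π : List ℕ) → IsPerm n π →
    ((Des (swu π) ≡ Des π) × (Des (swd π) ≡ Des π))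
    × (Av (3 ∷ 1 ∷ 2 ∷ []) π → (des (swr π) ≡ des (inv π)) × (des (inv π) ≡ des π))
    × (Av (1 ∷ 3 ∷ 2 ∷ []) π → (des (swl π) ≡ des (inv π)) × (des (inv π) ≡ des π))
lemma4p4 n π isPerm =
  (proj₂ (perm-Des-swu pm) , proj₂ (perm-Des-swd pm)) ,
  (λ av → des-swr , des-inv≡des-312 pm (Av⇒Avoids312 av)) ,
  (λ av → des-swl , des-inv≡des-132 pm (Av⇒Avoids132 av))
  where
  open ≡-Reasoning
  pm = IsPerm⇒Perm isPerm
  pm⁻¹ = perm-inv pm

  des-swr : des (swr π) ≡ des (inv π)
  des-swr = begin
    des (swr π)              ≡⟨ cong des (swr≡inv∘swu∘inv pm) ⟩
    des (inv (swu (inv π)))  ≡⟨ des-inv≡des-132 (proj₁ (perm-Des-swu pm⁻¹)) (swu-avoids132 pm⁻¹) ⟩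
    des (swu (inv π))        ≡⟨ cong length (proj₂ (perm-Des-swu pm⁻¹)) ⟩
    des (inv π)              ∎

  des-swl : des (swl π) ≡ des (inv π)
  des-swl = begin
    des (swl π)              ≡⟨ cong des (swl≡inv∘swd∘inv pm) ⟩
    des (inv (swd (inv π)))  ≡⟨ des-inv≡des-231 (proj₁ (perm-Des-swd pm⁻¹)) (swd-avoids231 pm⁻¹) ⟩
    des (swd (inv π))        ≡⟨ cong length (proj₂ (perm-Des-swd pm⁻¹)) ⟩
    des (inv π)              ∎
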